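{- Let $G$ be a dynamic bipartite graph with $n$ nodes on each side, undergoing online edge insertions and deletions, with the guarantee that its maximum degree is at most $k$ at all times, and let $h\ge 1$ be an integer. Then there is a deterministic algorithm that maintains a proper $(k+h)$-edge-coloring of $G$ with amortized $O(\sqrt{nk/h})$ recolorings per insertion.
   Context: A recoloring is a change of the color of an existing edge (coloring a newly inserted edge also counts as one operation). The algorithm must, after each update, hold a proper edge coloring of the current graph using colors $\{1,\dots,k+h\}$. -}

module Defs where

open import Data.Nat using (ℕ; zero; suc; _+_; _*_; _≤_)
open import Data.Fin using (Fin; _≟_)
open import Data.Bool using (Bool; true; false; if_then_else_; _∧_; not)
open import Data.Maybe using (Maybe; just; nothing)
import Data.Maybe.Properties as MaybeP
open import Data.List using (List; []; _∷_; map; allFin)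
open import Data.Nat.ListAction using (sum)
open import Data.Product using (Σ; _×_; _,_)
open import Data.Unit using (⊤)
open import Relation.Nullary using (¬_; does)
open import Relation.Binary.PropositionalEquality using (_≡_; _≢_)

-- Simple bipartite graphs with n nodes on each side (left side Fin n,
-- right side Fin n), given by their bipartite adjacency relation.

Graph : ℕ → Set
Graph n = Fin n → Fin n → Bool

empty : ∀ {n} → Graph n
empty _ _ = false

count : ∀ {n} → (Fin n → Bool) → ℕ
count {n} f = sum (map (λ i → if f i then 1 else 0) (allFin n))

degL : ∀ {n} → Graph n → Fin n → ℕ
degL G u = count (λ v → G u v)

degR : ∀ {n} → Graph n → Fin n → ℕ
degR G v = count (λ u → G u v)

MaxDeg≤ : ∀ {n} → ℕ → Graph n → Set
MaxDeg≤ k G = (∀ u → degL G u ≤ k) × (∀ v → degR G v ≤ k)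

data Update (n : ℕ) : Set where
  ins : Fin n → Fin n → Update n
  del : Fin n → Fin n → Update n

apply : ∀ {n} → Graph n → Update n → Graph n
apply G (ins u v) u' v' = if does (u ≟ u') ∧ does (v ≟ v') then true  else G u' v'
apply G (del u v) u' v' = if does (u ≟ u') ∧ does (v ≟ v') then false else G u' v'

Applicable : ∀ {n} → Graph n → Update n → Set
Applicable G (ins u v) = G u v ≡ false
Applicable G (del u v) = G u v ≡ true

Valid : ∀ {n} → ℕ → Graph n → List (Update n) → Set
Valid k G []       = ⊤
Valid k G (x ∷ xs) = Applicable G x × MaxDeg≤ k (apply G x) × Valid k (apply G x) xs

isIns : ∀ {n} → Update n → Bool
isIns (ins _ _) = true
isIns (del _ _) = false

insertions : ∀ {n} → List (Update n) → ℕ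
insertions []       = 0
insertions (x ∷ xs) = (if isIns x then 1 else 0) + insertions xs

-- Edge colorings with colors Fin c (the colors {1,…,c});
-- nothing = the pair is uncolored (not an edge).

Coloring : ℕ → ℕ → Set
Coloring n c = Fin n → Fin n → Maybe (Fin c)

Proper : ∀ {n c} → Graph n → Coloring n c → Set
Proper {n} G col =
  (∀ u v → G u v ≡ true → Σ (Fin _) λ a → col u v ≡ just a) ×
  (∀ u v → G u v ≡ false → col u v ≡ nothing) ×
  (∀ u v v' → v ≢ v' → G u v ≡ true → G u v' ≡ true → col u v ≢ col u v') ×
  (∀ u u' v → u ≢ u' → G u v ≡ true → G u' v ≡ true → col u v ≢ col u' v)

-- number of recolorings from col to col' when the current graph is G':
-- edges of G' whose color changed (coloring a newly inserted edge counts)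
recolorings : ∀ {n c} → Graph n → Coloring n c → Coloring n c → ℕ
recolorings G' col col' =
  sum (map (λ u → count (λ v → G' u v ∧ not (does (MaybeP.≡-dec _≟_ (col u v) (col' u v)))))
           (allFin _))

-- Deterministic online algorithms: a state machine processing one
-- update at a time (it only sees the past), exposing a coloring.

record Algorithm (n c : ℕ) : Set₁ where
  field
    State : Set
    init  : State
    step  : State → Update n → State
    col   : State → Coloring n c
open Algorithm public

ProperAlong : ∀ {n c} → (A : Algorithm n c) → Graph n → State A → List (Update n) → Set
ProperAlong A G s []       = Proper G (col A s)
ProperAlong A G s (x ∷ xs) = Proper G (col A s) × ProperAlong A (apply G x) (step A s x) xs

cost : ∀ {n c} → (A : Algorithm n c) → Graph n → State A → List (Update n) → ℕ
cost A G s []       = 0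
cost A G s (x ∷ xs) =
  recolorings (apply G x) (col A s) (col A (step A s x)) + cost A (apply G x) (step A s x) xs

-- Colours i ↑ˡ h are ordinary and k ↑ʳ r are reserved. To insert (u, v), take the least used
-- reserved colour c, an ordinary colour α free at u and an ordinary colour β free at v. Flipping the
-- c/α-alternating path that starts at u, and then the c/β-alternating path that starts at v, frees c
-- at both u and v, so (u, v) can be coloured c. A flip recolours at most 2|c| + 2 edges and never
-- increases the number of reserved-coloured edges, so after t insertions since the last rebuild
-- h|c| ≤ t. Once t reaches m·h, where m is least with nk ≤ m²h, every reserved edge is recoloured
-- with ordinary colours (by the same flips, as degrees stay at most k); this costs at most
-- nk ≤ m·t recolourings, which is paid by the potential m·t. Hence an insertion costs at most
-- 5(m + 1) recolourings amortised.

module Submission where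

open import Defs
open import Data.Nat using (ℕ; zero; suc; _+_; _*_; _≤_; _<_; z≤n; s≤s; _≤?_; _<?_)
open import Data.Nat.Properties hiding (_≟_)
import Data.Nat.ListAction as List
open import Data.Fin using (Fin; zero; suc; toℕ; punchIn; punchOut; join; splitAt; _↑ˡ_; _↑ʳ_; _≟_)
open import Data.Fin.Properties using (any?; all?; punchIn-injective; punchInᵢ≢i; punchOut-injective; punchIn-punchOut; splitAt-join)
import Data.Fin.Properties as Fin
open import Data.Fin.Permutation.Components using (transpose)
open import Data.Bool using (Bool; true; false; not; if_then_else_; _∧_; _∨_)
open import Data.Bool.Properties using (∨-zeroʳ; ∧-zeroʳ; ∧-conicalˡ; ∧-conicalʳ)
import Data.Bool.Properties as Bool
open import Data.Maybe using (Maybe; just; nothing; is-just; fromMaybe; _>>=_)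
import Data.Maybe as Maybe
import Data.Maybe.Properties as Maybeₚ
open import Data.Sum using (_⊎_; inj₁; inj₂)
import Data.Sum.Properties as Sum
open import Data.Product using (Σ; _×_; _,_; proj₁; proj₂)
open import Data.Empty using (⊥; ⊥-elim)
open import Data.List using (List; []; _∷_; map; allFin; tabulate; foldl; cartesianProduct)
open import Data.List.Properties using (map-tabulate)
open import Data.List.Membership.Propositional using (_∈_)
open import Data.List.Membership.Propositional.Properties using (∈-allFin; ∈-cartesianProduct⁺)
open import Data.List.Relation.Unary.Any using (here; there)
open import Function using (_∘_; id; _⇔_; mk⇔; Equivalence)
open import Function.Properties.Equivalence using () renaming (sym to ⇔-sym)
open import Relation.Nullary using (¬_; ¬?; Dec; yes; no; does; _×-dec_; contradiction)
open import Relation.Nullary.Decidable using (dec-true; dec-false; does-⇔)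
open import Relation.Binary.Definitions using (DecidableEquality; tri<; tri≈; tri>)
open import Relation.Binary.PropositionalEquality hiding ([_])
open import Algebra.Properties.CommutativeMonoid.Sum +-0-commutativeMonoid
  using (sum; sum-syntax; sum-cong-≗; ∑-distrib-+)

open Equivalence using (to; from)

-- Finite sums and counting

dec-true⁻¹ : ∀ {A : Set} (a? : Dec A) → does a? ≡ true → A
dec-true⁻¹ (yes a) _ = a

[_] : Bool → ℕ
[ b ] = if b then 1 else 0

sum-map-allFin : ∀ {m} (f : Fin m → ℕ) → List.sum (map f (allFin m)) ≡ sum f
sum-map-allFin f = trans (cong List.sum (map-tabulate id f)) (listSum-tabulate f)
  where
  listSum-tabulate : ∀ {m} (f : Fin m → ℕ) → List.sum (tabulate f) ≡ sum f
  listSum-tabulate {zero}  f = refl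
  listSum-tabulate {suc m} f = cong (f zero +_) (listSum-tabulate (f ∘ suc))

sum-mono-≤ : ∀ {m} {f g : Fin m → ℕ} → (∀ i → f i ≤ g i) → sum f ≤ sum g
sum-mono-≤ {zero}  f≤g = z≤n
sum-mono-≤ {suc m} f≤g = +-mono-≤ (f≤g zero) (sum-mono-≤ (f≤g ∘ suc))

sum-const : ∀ m c → ∑[ i < m ] c ≡ m * c
sum-const zero    c = refl
sum-const (suc m) c = cong (c +_) (sum-const m c)

≤-sum : ∀ {m} (f : Fin m → ℕ) i → f i ≤ sum f
≤-sum f zero    = m≤m+n _ _
≤-sum f (suc i) = ≤-trans (≤-sum (f ∘ suc) i) (m≤n+m _ (f zero))

sum-*-distribˡ : ∀ {m} c (f : Fin m → ℕ) → ∑[ i < m ] (c * f i) ≡ c * sum f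
sum-*-distribˡ {zero}  c f = sym (*-zeroʳ c)
sum-*-distribˡ {suc m} c f =
  trans (cong (c * f zero +_) (sum-*-distribˡ c (f ∘ suc))) (sym (*-distribˡ-+ c (f zero) _))

sum-zero : ∀ {m} {f : Fin m → ℕ} → (∀ i → f i ≡ 0) → sum f ≡ 0
sum-zero {m} f≡0 = trans (sum-cong-≗ f≡0) (trans (sum-const m 0) (*-zeroʳ m))

count-sum : ∀ {m} (P : Fin m → Bool) → count P ≡ ∑[ i < m ] [ P i ]
count-sum P = sum-map-allFin (λ i → [ P i ])

count-cong : ∀ {m} {P Q : Fin m → Bool} → (∀ i → P i ≡ Q i) → count P ≡ count Q
count-cong {P = P} {Q} P≗Q = begin
  count P             ≡⟨ count-sum P ⟩
  sum (λ i → [ P i ]) ≡⟨ sum-cong-≗ (cong [_] ∘ P≗Q) ⟩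
  sum (λ i → [ Q i ]) ≡⟨ count-sum Q ⟨
  count Q             ∎
  where open ≡-Reasoning

count-mono : ∀ {m} {P Q : Fin m → Bool} → (∀ i → P i ≡ true → Q i ≡ true) → count P ≤ count Q
count-mono {P = P} {Q} P⇒Q = begin
  count P             ≡⟨ count-sum P ⟩
  sum (λ i → [ P i ]) ≤⟨ sum-mono-≤ pointwise ⟩
  sum (λ i → [ Q i ]) ≡⟨ count-sum Q ⟨
  count Q             ∎
  where
  open ≤-Reasoning
  pointwise : ∀ i → [ P i ] ≤ [ Q i ]
  pointwise i with P i in Pi
  ... | false = z≤n
  ... | true  rewrite P⇒Q i Pi = ≤-refl

count-none : ∀ {m} {P : Fin m → Bool} → (∀ i → P i ≡ false) → count P ≡ 0
count-none {P = P} none = trans (count-sum P) (sum-zero (cong [_] ∘ none))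

count-≥1 : ∀ {m} (P : Fin m → Bool) i → P i ≡ true → 1 ≤ count P
count-≥1 P i Pi = begin
  1                   ≡⟨ cong [_] Pi ⟨
  [ P i ]             ≤⟨ ≤-sum (λ j → [ P j ]) i ⟩
  sum (λ j → [ P j ]) ≡⟨ count-sum P ⟨
  count P             ∎
  where open ≤-Reasoning

count-∨ : ∀ {m} (P Q : Fin m → Bool) → count (λ i → P i ∨ Q i) ≤ count P + count Q
count-∨ P Q = begin
  count (λ i → P i ∨ Q i)             ≡⟨ count-sum (λ i → P i ∨ Q i) ⟩
  sum (λ i → [ P i ∨ Q i ])           ≤⟨ sum-mono-≤ (λ i → [∨]≤ (P i) (Q i)) ⟩
  sum (λ i → [ P i ] + [ Q i ])       ≡⟨ ∑-distrib-+ (λ i → [ P i ]) (λ i → [ Q i ]) ⟩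
  sum (λ i → [ P i ]) + sum (λ i → [ Q i ]) ≡⟨ cong₂ _+_ (count-sum P) (count-sum Q) ⟨
  count P + count Q                   ∎
  where
  open ≤-Reasoning
  [∨]≤ : ∀ p q → [ p ∨ q ] ≤ [ p ] + [ q ]
  [∨]≤ true  q = s≤s z≤n
  [∨]≤ false q = ≤-refl

count-≤1 : ∀ {m} (P : Fin m → Bool) → (∀ i j → P i ≡ true → P j ≡ true → i ≡ j) → count P ≤ 1
count-≤1 P unique = subst (_≤ 1) (sym (count-sum P)) (go P unique)
  where
  go : ∀ {m} (P : Fin m → Bool) → (∀ i j → P i ≡ true → P j ≡ true → i ≡ j) → sum (λ i → [ P i ]) ≤ 1
  go {zero}  P unique = z≤n
  go {suc m} P unique with P zero in P0
  ... | false = go (P ∘ suc) (λ i j Pi Pj → Fin.suc-injective (unique (suc i) (suc j) Pi Pj))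
  ... | true  = s≤s (≤-reflexive (sum-zero rest))
    where
    rest : ∀ i → [ P (suc i) ] ≡ 0
    rest i with P (suc i) in Pi
    ... | false = refl
    ... | true with () ← unique zero (suc i) P0 Pi

count-delete : ∀ {m} {P P′ : Fin m → Bool} v → P v ≡ true → P′ v ≡ false →
               (∀ i → i ≢ v → P′ i ≡ P i) → count P′ < count P
count-delete {P = P} {P′} v Pv P′v others = begin
  suc (count P′)                                ≡⟨ +-comm 1 (count P′) ⟩
  count P′ + 1                                  ≤⟨ +-monoʳ-≤ (count P′) (count-≥1 _ v (dec-true (v ≟ v) refl)) ⟩
  count P′ + count (λ i → does (v ≟ i))         ≡⟨ cong₂ _+_ (count-sum P′) (count-sum (λ i → does (v ≟ i))) ⟩
  sum (λ i → [ P′ i ]) + sum (λ i → [ does (v ≟ i) ]) ≡⟨ ∑-distrib-+ (λ i → [ P′ i ]) (λ i → [ does (v ≟ i) ]) ⟨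
  sum (λ i → [ P′ i ] + [ does (v ≟ i) ])       ≤⟨ sum-mono-≤ pointwise ⟩
  sum (λ i → [ P i ])                           ≡⟨ count-sum P ⟨
  count P                                       ∎
  where
  open ≤-Reasoning
  pointwise : ∀ i → [ P′ i ] + [ does (v ≟ i) ] ≤ [ P i ]
  pointwise i with v ≟ i
  ... | yes refl rewrite Pv | P′v = ≤-refl
  ... | no v≢i rewrite others i (v≢i ∘ sym) = ≤-reflexive (+-identityʳ _)

count-injection : ∀ {m k} (P : Fin m → Bool) (f : Fin k → Fin m) →
                  (∀ i j → f i ≡ f j → i ≡ j) → (∀ i → P (f i) ≡ true) → k ≤ count P
count-injection P f f-inj P∘f = subst (_ ≤_) (sym (count-sum P)) (go P f f-inj P∘f)
  where
  go : ∀ {m k} (P : Fin m → Bool) (f : Fin k → Fin m) →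
       (∀ i j → f i ≡ f j → i ≡ j) → (∀ i → P (f i) ≡ true) → k ≤ sum (λ i → [ P i ])
  go {zero} {zero}  P f f-inj P∘f = z≤n
  go {zero} {suc k} P f f-inj P∘f with () ← f zero
  go {suc m} {k} P f f-inj P∘f with any? (λ i → f i ≟ zero)
  ... | no zero∉f = ≤-trans (go (P ∘ suc) g g-inj P∘g) (m≤n+m _ _)
    where
    f≢0 : ∀ i → zero ≢ f i
    f≢0 i e = zero∉f (i , sym e)
    g : Fin k → Fin m
    g i = punchOut (f≢0 i)
    g-inj : ∀ i j → g i ≡ g j → i ≡ j
    g-inj i j e = f-inj i j (punchOut-injective (f≢0 i) (f≢0 j) e)
    P∘g : ∀ i → P (suc (g i)) ≡ true
    P∘g i = trans (cong P (punchIn-punchOut (f≢0 i))) (P∘f i)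
  go {suc m} {suc k} P f f-inj P∘f | yes (i₀ , fi₀≡0) =
    subst (λ b → suc k ≤ [ b ] + sum (λ i → [ P (suc i) ])) (sym P0) (s≤s (go (P ∘ suc) g g-inj P∘g))
    where
    P0 : P zero ≡ true
    P0 = subst (λ i → P i ≡ true) fi₀≡0 (P∘f i₀)
    f≢0 : ∀ t → zero ≢ f (punchIn i₀ t)
    f≢0 t e = punchInᵢ≢i i₀ t (f-inj _ _ (trans (sym e) (sym fi₀≡0)))
    g : Fin k → Fin m
    g t = punchOut (f≢0 t)
    g-inj : ∀ i j → g i ≡ g j → i ≡ j
    g-inj i j e = punchIn-injective i₀ i j (f-inj _ _ (punchOut-injective (f≢0 i) (f≢0 j) e))
    P∘g : ∀ i → P (suc (g i)) ≡ true
    P∘g i = trans (cong P (punchIn-punchOut (f≢0 i))) (P∘f _)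

argmin : ∀ {m} → (Fin (suc m) → ℕ) → Fin (suc m)
argmin {zero}  f = zero
argmin {suc m} f with f zero ≤? f (suc (argmin (f ∘ suc)))
... | yes _ = zero
... | no  _ = suc (argmin (f ∘ suc))

argmin-minimal : ∀ {m} (f : Fin (suc m) → ℕ) j → f (argmin f) ≤ f j
argmin-minimal {zero}  f zero = ≤-refl
argmin-minimal {suc m} f j with f zero ≤? f (suc (argmin (f ∘ suc)))
argmin-minimal {suc m} f zero    | yes _   = ≤-refl
argmin-minimal {suc m} f (suc i) | yes f₀≤ = ≤-trans f₀≤ (argmin-minimal (f ∘ suc) i)
argmin-minimal {suc m} f zero    | no  f₀≰ = <⇒≤ (≰⇒> f₀≰)
argmin-minimal {suc m} f (suc i) | no  _   = argmin-minimal (f ∘ suc) i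

argmin-*≤sum : ∀ {m} (f : Fin (suc m) → ℕ) → suc m * f (argmin f) ≤ sum f
argmin-*≤sum {m} f = ≤-trans (≤-reflexive (sym (sum-const (suc m) (f (argmin f))))) (sum-mono-≤ (argmin-minimal f))

module LeastSearch {P : ℕ → Set} (P? : ∀ m → Dec (P m)) where

  searchFrom : ℕ → ℕ → ℕ
  searchFrom i zero       = i
  searchFrom i (suc fuel) with P? i
  ... | yes _ = i
  ... | no  _ = searchFrom (suc i) fuel

  searchFrom-satisfies : ∀ i fuel → P (i + fuel) → P (searchFrom i fuel)
  searchFrom-satisfies i zero       p rewrite +-identityʳ i = p
  searchFrom-satisfies i (suc fuel) p with P? i
  ... | yes pᵢ = pᵢ
  ... | no  _  = searchFrom-satisfies (suc i) fuel (subst P (+-suc i fuel) p)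

  searchFrom-minimal : ∀ i fuel {m} → (∀ j → j < i → ¬ P j) → P m → searchFrom i fuel ≤ m
  searchFrom-minimal i fuel {m} below p with fuel | i ≤? m
  ... | _      | no i≰m = ⊥-elim (below m (≰⇒> i≰m) p)
  ... | zero   | yes i≤m = i≤m
  ... | suc f  | yes i≤m with P? i
  ...   | yes _  = i≤m
  ...   | no ¬pᵢ = searchFrom-minimal (suc i) f below′ p
    where
    below′ : ∀ j → j < suc i → ¬ P j
    below′ j j<1+i with m≤n⇒m<n∨m≡n (≤-pred j<1+i)
    ... | inj₁ j<i  = below j j<i
    ... | inj₂ refl = ¬pᵢ

  least : ℕ → ℕ
  least bound = searchFrom 0 bound

  least-satisfies : ∀ {bound} → P bound → P (least bound)
  least-satisfies {bound} = searchFrom-satisfies 0 bound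

  least-minimal : ∀ bound {m} → P m → least bound ≤ m
  least-minimal bound = searchFrom-minimal 0 bound (λ _ ())

-- Edge colourings of bipartite graphs

variable
  n K : ℕ

Vertex : ℕ → Set
Vertex n = Fin n ⊎ Fin n

pattern left x  = inj₁ x
pattern right y = inj₂ y

_≟ᵛ_ : DecidableEquality (Vertex n)
_≟ᵛ_ = Sum.≡-dec _≟_ _≟_

sameSide : Vertex n → Vertex n → Bool
sameSide (left _)  (left _)  = true
sameSide (right _) (right _) = true
sameSide _         _         = false

sameSide-refl : ∀ (z : Vertex n) → sameSide z z ≡ true
sameSide-refl (left _)  = refl
sameSide-refl (right _) = refl

sameSide-sym : ∀ (z z′ : Vertex n) → sameSide z z′ ≡ sameSide z′ z
sameSide-sym (left _)  (left _)  = refl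
sameSide-sym (left _)  (right _) = refl
sameSide-sym (right _) (left _)  = refl
sameSide-sym (right _) (right _) = refl

sameSide-trans : ∀ (p q r : Vertex n) → sameSide p q ≡ true → sameSide p r ≡ sameSide q r
sameSide-trans (left _)  (left _)  (left _)  _ = refl
sameSide-trans (left _)  (left _)  (right _) _ = refl
sameSide-trans (right _) (right _) (left _)  _ = refl
sameSide-trans (right _) (right _) (right _) _ = refl

opposite-opposite : ∀ (r p q : Vertex n) → sameSide r p ≡ false → sameSide r q ≡ false → sameSide p q ≡ true
opposite-opposite (left _)  (right _) (right _) _  _  = refl
opposite-opposite (right _) (left _)  (left _)  _  _  = refl
opposite-opposite (left _)  (left _)  _         () _
opposite-opposite (left _)  (right _) (left _)  _  ()
opposite-opposite (right _) (right _) _         () _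
opposite-opposite (right _) (left _)  (right _) _  ()

Vertex↣Fin : Vertex n → Fin (n + n)
Vertex↣Fin = join _ _

Vertex↣Fin-injective : ∀ (z z′ : Vertex n) → Vertex↣Fin z ≡ Vertex↣Fin z′ → z ≡ z′
Vertex↣Fin-injective {n} z z′ e =
  trans (sym (splitAt-join n n z)) (trans (cong (splitAt n) e) (splitAt-join n n z′))

_≟ᶜ_ : DecidableEquality (Maybe (Fin K))
_≟ᶜ_ = Maybeₚ.≡-dec _≟_

ConflictFree : Coloring n K → Set
ConflictFree col = (∀ x y y′ c → col x y ≡ just c → col x y′ ≡ just c → y ≡ y′)
                 × (∀ x x′ y c → col x y ≡ just c → col x′ y ≡ just c → x ≡ x′)

Adj : Coloring n K → Fin K → Vertex n → Vertex n → Set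
Adj col c (left x)  (right y) = col x y ≡ just c
Adj col c (right y) (left x)  = col x y ≡ just c
Adj col c _         _         = ⊥

Free : Coloring n K → Fin K → Vertex n → Set
Free col c (left x)  = ∀ y → col x y ≢ just c
Free col c (right y) = ∀ x → col x y ≢ just c

Adj-sym : ∀ (col : Coloring n K) c z z′ → Adj col c z z′ → Adj col c z′ z
Adj-sym col c (left x)  (right y) p = p
Adj-sym col c (right y) (left x)  p = p

Adj-opposite : ∀ (col : Coloring n K) c z z′ → Adj col c z z′ → sameSide z z′ ≡ false
Adj-opposite col c (left x)  (right y) p = refl
Adj-opposite col c (right y) (left x)  p = refl

Adj-common : ∀ {col : Coloring n K} {c d} z₁ z₂ z′ → Adj col c z₁ z′ → Adj col d z₂ z′ → sameSide z₁ z₂ ≡ true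
Adj-common (left _)  (left _)  (right _) _  _  = refl
Adj-common (right _) (right _) (left _)  _  _  = refl
Adj-common (left _)  _         (left _)  () _
Adj-common (right _) _         (right _) () _
Adj-common (left _)  (right _) (right _) _  ()
Adj-common (right _) (left _)  (left _)  _  ()

Adj-unique : ∀ {col : Coloring n K} → ConflictFree col → ∀ c z z₁ z₂ → Adj col c z z₁ → Adj col c z z₂ → z₁ ≡ z₂
Adj-unique (rows , cols) c (left x)  (right y₁) (right y₂) p q = cong right (rows x y₁ y₂ c p q)
Adj-unique (rows , cols) c (right y) (left x₁)  (left x₂)  p q = cong left (cols x₁ x₂ y c p q)

Free-¬Adj : ∀ {col : Coloring n K} {c} z → Free col c z → ∀ z′ → ¬ Adj col c z z′
Free-¬Adj (left x)  free (right y) = free y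
Free-¬Adj (right y) free (left x)  = free x

free? : ∀ (col : Coloring n K) c z → Dec (Free col c z)
free? col c (left x)  = all? (λ y → ¬? (col x y ≟ᶜ just c))
free? col c (right y) = all? (λ x → ¬? (col x y ≟ᶜ just c))

neighbour : Coloring n K → Fin K → Vertex n → Maybe (Vertex n)
neighbour col c (left x) with any? (λ y → col x y ≟ᶜ just c)
... | yes (y , _) = just (right y)
... | no _        = nothing
neighbour col c (right y) with any? (λ x → col x y ≟ᶜ just c)
... | yes (x , _) = just (left x)
... | no _        = nothing

neighbour-Adj : ∀ (col : Coloring n K) c z {z′} → neighbour col c z ≡ just z′ → Adj col c z z′
neighbour-Adj col c (left x) e with any? (λ y → col x y ≟ᶜ just c)
neighbour-Adj col c (left x) refl | yes (y , p) = p
neighbour-Adj col c (right y) e with any? (λ x → col x y ≟ᶜ just c)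
neighbour-Adj col c (right y) refl | yes (x , p) = p

neighbour-Free : ∀ (col : Coloring n K) c z → neighbour col c z ≡ nothing → Free col c z
neighbour-Free col c (left x) e with any? (λ y → col x y ≟ᶜ just c)
... | no none = λ y p → none (y , p)
neighbour-Free col c (right y) e with any? (λ x → col x y ≟ᶜ just c)
... | no none = λ x p → none (x , p)

neighbour-complete : ∀ {col : Coloring n K} → ConflictFree col → ∀ c z z′ → Adj col c z z′ → neighbour col c z ≡ just z′
neighbour-complete {col = col} cf c z z′ p with neighbour col c z in e
... | just z″ = cong just (Adj-unique cf c z z″ z′ (neighbour-Adj col c z e) p)
... | nothing = ⊥-elim (Free-¬Adj z (neighbour-Free col c z e) z′ p)

classRow : Coloring n K → Fin K → Fin n → ℕ
classRow col c x = count (λ y → does (col x y ≟ᶜ just c))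

classSize : Coloring n K → Fin K → ℕ
classSize {n} col c = ∑[ x < n ] classRow col c x

classRow≤1 : ∀ {col : Coloring n K} → ConflictFree col → ∀ c x → classRow col c x ≤ 1
classRow≤1 {col = col} (rows , _) c x = count-≤1 _ λ y y′ p q →
  rows x y y′ c (dec-true⁻¹ (col x y ≟ᶜ just c) p) (dec-true⁻¹ (col x y′ ≟ᶜ just c) q)

differ : Maybe (Fin K) → Maybe (Fin K) → Bool
differ m m′ = not (does (m ≟ᶜ m′))

differ-≡ : ∀ {m m′ : Maybe (Fin K)} → m ≡ m′ → differ m m′ ≡ false
differ-≡ {m = m} {m′} e rewrite dec-true (m ≟ᶜ m′) e = refl

rowChanges : Coloring n K → Coloring n K → Fin n → ℕ
rowChanges col col′ x = count (λ y → differ (col x y) (col′ x y))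

changes : Coloring n K → Coloring n K → ℕ
changes {n} col col′ = ∑[ x < n ] rowChanges col col′ x

changes-trans : ∀ (c₁ c₂ c₃ : Coloring n K) → changes c₁ c₃ ≤ changes c₁ c₂ + changes c₂ c₃
changes-trans {n} c₁ c₂ c₃ = begin
  changes c₁ c₃                                        ≤⟨ sum-mono-≤ row ⟩
  ∑[ x < n ] (rowChanges c₁ c₂ x + rowChanges c₂ c₃ x) ≡⟨ ∑-distrib-+ (rowChanges c₁ c₂) (rowChanges c₂ c₃) ⟩
  changes c₁ c₂ + changes c₂ c₃                        ∎
  where
  open ≤-Reasoning
  differ-trans : ∀ m₁ m₂ m₃ → differ m₁ m₃ ≡ true → differ m₁ m₂ ∨ differ m₂ m₃ ≡ true
  differ-trans m₁ m₂ m₃ d with m₁ ≟ᶜ m₂ | m₂ ≟ᶜ m₃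
  ... | no _     | _        = refl
  ... | yes _    | no _     = refl
  ... | yes refl | yes refl with () ← trans (sym d) (differ-≡ {m = m₁} refl)
  row : ∀ x → rowChanges c₁ c₃ x ≤ rowChanges c₁ c₂ x + rowChanges c₂ c₃ x
  row x = ≤-trans (count-mono λ y → differ-trans (c₁ x y) (c₂ x y) (c₃ x y))
                  (count-∨ (λ y → differ (c₁ x y) (c₂ x y)) (λ y → differ (c₂ x y) (c₃ x y)))

SameSupport : Coloring n K → Coloring n K → Set
SameSupport c₁ c₂ = ∀ x y → is-just (c₁ x y) ≡ is-just (c₂ x y)

degree : Coloring n K → Vertex n → ℕ
degree col (left x)  = count (λ y → is-just (col x y))
degree col (right y) = count (λ x → is-just (col x y))

degree-cong : ∀ {c₁ c₂ : Coloring n K} → SameSupport c₁ c₂ → ∀ z → degree c₁ z ≡ degree c₂ z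
degree-cong same (left x)  = count-cong (same x)
degree-cong same (right y) = count-cong (λ x → same x y)

_ᵀ : Coloring n K → Coloring n K
(col ᵀ) y x = col x y

free-colour-exists : ∀ {k} {col : Coloring n K} (f : Fin k → Fin K) → (∀ i j → f i ≡ f j → i ≡ j) →
                     ∀ z → degree col z < k → Σ (Fin k) λ i → Free col (f i) z
free-colour-exists {n} {k = k} {col} f f-inj (left x) deg<k with any? (λ i → free? col (f i) (left x))
... | yes found = found
... | no  none  = ⊥-elim (<⇒≱ deg<k (count-injection (λ y → is-just (col x y)) g g-injective g-coloured))
  where
  used : ∀ i → Σ (Fin n) λ y → col x y ≡ just (f i)
  used i with any? (λ y → col x y ≟ᶜ just (f i))
  ... | yes found = found
  ... | no  free  = ⊥-elim (none (i , λ y e → free (y , e)))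
  g : Fin k → Fin n
  g i = proj₁ (used i)
  g-injective : ∀ i j → g i ≡ g j → i ≡ j
  g-injective i j e = f-inj i j (Maybeₚ.just-injective (trans (sym (proj₂ (used i))) (trans (cong (col x) e) (proj₂ (used j)))))
  g-coloured : ∀ i → is-just (col x (g i)) ≡ true
  g-coloured i rewrite proj₂ (used i) = refl
free-colour-exists {col = col} f f-inj (right y) deg<k = free-colour-exists {col = col ᵀ} f f-inj (left y) deg<k

cell? : ∀ (u v x y : Fin n) → Dec (u ≡ x × v ≡ y)
cell? u v x y = (u ≟ x) ×-dec (v ≟ y)

update : Coloring n K → Fin n → Fin n → Maybe (Fin K) → Coloring n K
update col u v m x y = if does (cell? u v x y) then m else col x y

update-here : ∀ (col : Coloring n K) u v m → update col u v m u v ≡ m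
update-here col u v m rewrite dec-true (cell? u v u v) (refl , refl) = refl

update-elsewhere : ∀ (col : Coloring n K) u v m {x y} → ¬ (u ≡ x × v ≡ y) → update col u v m x y ≡ col x y
update-elsewhere col u v m {x} {y} elsewhere rewrite dec-false (cell? u v x y) elsewhere = refl

update-cell : ∀ (col : Coloring n K) u v m x y →
              (u ≡ x × v ≡ y × update col u v m x y ≡ m) ⊎ (¬ (u ≡ x × v ≡ y) × update col u v m x y ≡ col x y)
update-cell col u v m x y with cell? u v x y
... | yes (refl , refl) = inj₁ (refl , refl , update-here col u v m)
... | no elsewhere      = inj₂ (elsewhere , update-elsewhere col u v m elsewhere)

update-support : ∀ {c₁ c₂ : Coloring n K} u v m → SameSupport c₁ c₂ → SameSupport (update c₁ u v m) (update c₂ u v m)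
update-support {c₁ = c₁} {c₂} u v m same x y with update-cell c₁ u v m x y | update-cell c₂ u v m x y
... | inj₁ (_ , _ , s₁) | inj₁ (_ , _ , s₂) = cong is-just (trans s₁ (sym s₂))
... | inj₂ (_ , s₁)     | inj₂ (_ , s₂)     = trans (cong is-just s₁) (trans (same x y) (cong is-just (sym s₂)))
... | inj₁ (u≡x , v≡y , _) | inj₂ (elsewhere , _) = ⊥-elim (elsewhere (u≡x , v≡y))
... | inj₂ (elsewhere , _) | inj₁ (u≡x , v≡y , _) = ⊥-elim (elsewhere (u≡x , v≡y))

update-conflictFree : ∀ {col : Coloring n K} {u v c} → ConflictFree col → Free col c (left u) → Free col c (right v) →
                      ConflictFree (update col u v (just c))
update-conflictFree {col = col} {u} {v} {c} (rows , cols) free-u free-v = rows′ , cols′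
  where
  rows′ : ∀ x y y′ d → update col u v (just c) x y ≡ just d → update col u v (just c) x y′ ≡ just d → y ≡ y′
  rows′ x y y′ d e₁ e₂ with update-cell col u v (just c) x y | update-cell col u v (just c) x y′
  ... | inj₁ (_ , refl , _) | inj₁ (_ , refl , _) = refl
  ... | inj₁ (refl , _ , s₁) | inj₂ (_ , s₂) = ⊥-elim (free-u y′ (trans (sym s₂) (trans e₂ (trans (sym e₁) s₁))))
  ... | inj₂ (_ , s₁) | inj₁ (refl , _ , s₂) = ⊥-elim (free-u y (trans (sym s₁) (trans e₁ (trans (sym e₂) s₂))))
  ... | inj₂ (_ , s₁) | inj₂ (_ , s₂) = rows x y y′ d (trans (sym s₁) e₁) (trans (sym s₂) e₂)
  cols′ : ∀ x x′ y d → update col u v (just c) x y ≡ just d → update col u v (just c) x′ y ≡ just d → x ≡ x′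
  cols′ x x′ y d e₁ e₂ with update-cell col u v (just c) x y | update-cell col u v (just c) x′ y
  ... | inj₁ (refl , _ , _) | inj₁ (refl , _ , _) = refl
  ... | inj₁ (_ , refl , s₁) | inj₂ (_ , s₂) = ⊥-elim (free-v x′ (trans (sym s₂) (trans e₂ (trans (sym e₁) s₁))))
  ... | inj₂ (_ , s₁) | inj₁ (_ , refl , s₂) = ⊥-elim (free-v x (trans (sym s₁) (trans e₁ (trans (sym e₂) s₂))))
  ... | inj₂ (_ , s₁) | inj₂ (_ , s₂) = cols x x′ y d (trans (sym s₁) e₁) (trans (sym s₂) e₂)

erase-conflictFree : ∀ {col : Coloring n K} {u v} → ConflictFree col → ConflictFree (update col u v nothing)
erase-conflictFree {col = col} {u} {v} (rows , cols) = rows′ , cols′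
  where
  unchanged : ∀ {x y d} → update col u v nothing x y ≡ just d → col x y ≡ just d
  unchanged {x} {y} e with update-cell col u v nothing x y
  ... | inj₁ (_ , _ , s) with () ← trans (sym s) e
  ... | inj₂ (_ , s)     = trans (sym s) e
  rows′ : ∀ x y y′ d → update col u v nothing x y ≡ just d → update col u v nothing x y′ ≡ just d → y ≡ y′
  rows′ x y y′ d e₁ e₂ = rows x y y′ d (unchanged e₁) (unchanged e₂)
  cols′ : ∀ x x′ y d → update col u v nothing x y ≡ just d → update col u v nothing x′ y ≡ just d → x ≡ x′
  cols′ x x′ y d e₁ e₂ = cols x x′ y d (unchanged e₁) (unchanged e₂)

count-cell≤1 : ∀ (u v : Fin n) → ∑[ x < n ] count (λ y → does (cell? u v x y)) ≤ 1
count-cell≤1 {n} u v = begin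
  ∑[ x < n ] count (λ y → does (cell? u v x y)) ≤⟨ sum-mono-≤ row ⟩
  ∑[ x < n ] [ does (u ≟ x) ]                  ≡⟨ count-sum (λ x → does (u ≟ x)) ⟨
  count (λ x → does (u ≟ x))                   ≤⟨ count-≤1 _ (λ i j p q → trans (sym (dec-true⁻¹ (u ≟ i) p)) (dec-true⁻¹ (u ≟ j) q)) ⟩
  1                                            ∎
  where
  open ≤-Reasoning
  row : ∀ x → count (λ y → does (cell? u v x y)) ≤ [ does (u ≟ x) ]
  row x with u ≟ x
  ... | yes _ = count-≤1 _ (λ i j p q → trans (sym (dec-true⁻¹ (v ≟ i) p)) (dec-true⁻¹ (v ≟ j) q))
  ... | no _  = ≤-reflexive (count-none {m = n} {P = λ _ → false} (λ _ → refl))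

changes-update : ∀ (col : Coloring n K) u v m → changes col (update col u v m) ≤ 1
changes-update col u v m = ≤-trans (sum-mono-≤ λ x → count-mono (changed x)) (count-cell≤1 u v)
  where
  changed : ∀ x y → differ (col x y) (update col u v m x y) ≡ true → does (cell? u v x y) ≡ true
  changed x y d with update-cell col u v m x y
  ... | inj₁ (u≡x , v≡y , _) = dec-true (cell? u v x y) (u≡x , v≡y)
  ... | inj₂ (_ , s) with () ← trans (sym d) (differ-≡ (sym s))

classSize-update≤ : ∀ (col : Coloring n K) u v m d → classSize (update col u v m) d ≤ classSize col d + 1
classSize-update≤ {n} col u v m d = begin
  classSize (update col u v m) d                                    ≤⟨ sum-mono-≤ row ⟩
  ∑[ x < n ] (classRow col d x + count (λ y → does (cell? u v x y))) ≡⟨ ∑-distrib-+ (classRow col d) _ ⟩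
  classSize col d + ∑[ x < n ] count (λ y → does (cell? u v x y))   ≤⟨ +-monoʳ-≤ (classSize col d) (count-cell≤1 u v) ⟩
  classSize col d + 1                                               ∎
  where
  open ≤-Reasoning
  old-or-here : ∀ x y → does (update col u v m x y ≟ᶜ just d) ≡ true → does (col x y ≟ᶜ just d) ∨ does (cell? u v x y) ≡ true
  old-or-here x y p with update-cell col u v m x y
  ... | inj₁ (u≡x , v≡y , _) rewrite dec-true (cell? u v x y) (u≡x , v≡y) = ∨-zeroʳ _
  ... | inj₂ (_ , s) = cong (_∨ does (cell? u v x y)) (trans (cong (λ t → does (t ≟ᶜ just d)) (sym s)) p)
  row : ∀ x → classRow (update col u v m) d x ≤ classRow col d x + count (λ y → does (cell? u v x y))
  row x = ≤-trans (count-mono (old-or-here x)) (count-∨ (λ y → does (col x y ≟ᶜ just d)) (λ y → does (cell? u v x y)))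

classSize-update-other : ∀ (col : Coloring n K) u v {m} d → m ≢ just d → classSize (update col u v m) d ≤ classSize col d
classSize-update-other col u v {m} d m≢d = sum-mono-≤ λ x → count-mono (old x)
  where
  old : ∀ x y → does (update col u v m x y ≟ᶜ just d) ≡ true → does (col x y ≟ᶜ just d) ≡ true
  old x y p with update-cell col u v m x y
  ... | inj₁ (_ , _ , s) = ⊥-elim (m≢d (trans (sym s) (dec-true⁻¹ (_ ≟ᶜ just d) p)))
  ... | inj₂ (_ , s) = trans (cong (λ t → does (t ≟ᶜ just d)) (sym s)) p

erase-degree-left : ∀ (col : Coloring n K) x y {d} → col x y ≡ just d → degree (update col x y nothing) (left x) < degree col (left x)
erase-degree-left col x y p =
  count-delete {P = λ y′ → is-just (col x y′)} y (cong is-just p) (cong is-just (update-here col x y nothing)) others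
  where
  others : ∀ y′ → y′ ≢ y → is-just (update col x y nothing x y′) ≡ is-just (col x y′)
  others y′ y′≢y = cong is-just (update-elsewhere col x y nothing (λ (_ , y≡y′) → y′≢y (sym y≡y′)))

erase-degree-right : ∀ (col : Coloring n K) x y {d} → col x y ≡ just d → degree (update col x y nothing) (right y) < degree col (right y)
erase-degree-right col x y p =
  count-delete {P = λ x′ → is-just (col x′ y)} x (cong is-just p) (cong is-just (update-here col x y nothing)) others
  where
  others : ∀ x′ → x′ ≢ x → is-just (update col x y nothing x′ y) ≡ is-just (col x′ y)
  others x′ x′≢x = cong is-just (update-elsewhere col x y nothing (λ (x≡x′ , _) → x′≢x (sym x≡x′)))

Supports : Graph n → Coloring n K → Set
Supports G col = ∀ x y → is-just (col x y) ≡ G x y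

conflictFree-proper : ∀ {G : Graph n} {col : Coloring n K} → ConflictFree col → Supports G col → Proper G col
conflictFree-proper {G = G} {col} (rows , cols) sup = coloured , uncoloured , row-proper , col-proper
  where
  coloured : ∀ u v → G u v ≡ true → Σ (Fin _) λ c → col u v ≡ just c
  coloured u v e with col u v | sup u v
  ... | just c  | _  = c , refl
  ... | nothing | s with () ← trans s e
  uncoloured : ∀ u v → G u v ≡ false → col u v ≡ nothing
  uncoloured u v e with col u v | sup u v
  ... | nothing | _ = refl
  ... | just _  | s with () ← trans s e
  row-proper : ∀ u v v′ → v ≢ v′ → G u v ≡ true → G u v′ ≡ true → col u v ≢ col u v′
  row-proper u v v′ v≢v′ e _ same = let c , p = coloured u v e in v≢v′ (rows u v v′ c p (trans (sym same) p))
  col-proper : ∀ u u′ v → u ≢ u′ → G u v ≡ true → G u′ v ≡ true → col u v ≢ col u′ v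
  col-proper u u′ v u≢u′ e _ same = let c , p = coloured u v e in u≢u′ (cols u u′ v c p (trans (sym same) p))

apply-cell : ∀ (G : Graph n) u v x y →
             (u ≡ x × v ≡ y × apply G (ins u v) x y ≡ true × apply G (del u v) x y ≡ false)
           ⊎ (¬ (u ≡ x × v ≡ y) × apply G (ins u v) x y ≡ G x y × apply G (del u v) x y ≡ G x y)
apply-cell G u v x y with u ≟ x | v ≟ y
... | yes refl | yes refl = inj₁ (refl , refl , refl , refl)
... | yes _    | no v≢y   = inj₂ ((λ (_ , v≡y) → v≢y v≡y) , refl , refl)
... | no u≢x   | _        = inj₂ ((λ (u≡x , _) → u≢x u≡x) , refl , refl)

supports-ins : ∀ {G : Graph n} {col : Coloring n K} u v c → Supports G col → Supports (apply G (ins u v)) (update col u v (just c))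
supports-ins {G = G} {col} u v c sup x y with update-cell col u v (just c) x y | apply-cell G u v x y
... | inj₁ (_ , _ , s) | inj₁ (_ , _ , a , _) = trans (cong is-just s) (sym a)
... | inj₂ (_ , s)     | inj₂ (_ , a , _)     = trans (cong is-just s) (trans (sup x y) (sym a))
... | inj₁ (u≡x , v≡y , _) | inj₂ (elsewhere , _) = ⊥-elim (elsewhere (u≡x , v≡y))
... | inj₂ (elsewhere , _) | inj₁ (u≡x , v≡y , _) = ⊥-elim (elsewhere (u≡x , v≡y))

supports-del : ∀ {G : Graph n} {col : Coloring n K} u v → Supports G col → Supports (apply G (del u v)) (update col u v nothing)
supports-del {G = G} {col} u v sup x y with update-cell col u v nothing x y | apply-cell G u v x y
... | inj₁ (_ , _ , s) | inj₁ (_ , _ , _ , a) = trans (cong is-just s) (sym a)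
... | inj₂ (_ , s)     | inj₂ (_ , _ , a)     = trans (cong is-just s) (trans (sup x y) (sym a))
... | inj₁ (u≡x , v≡y , _) | inj₂ (elsewhere , _) = ⊥-elim (elsewhere (u≡x , v≡y))
... | inj₂ (elsewhere , _) | inj₁ (u≡x , v≡y , _) = ⊥-elim (elsewhere (u≡x , v≡y))

supports-maxDegree : ∀ {k} {G : Graph n} {col : Coloring n K} → Supports G col → MaxDeg≤ k G → ∀ z → degree col z ≤ k
supports-maxDegree sup (degL≤k , degR≤k) (left x)  = ≤-trans (≤-reflexive (count-cong (sup x))) (degL≤k x)
supports-maxDegree sup (degL≤k , degR≤k) (right y) = ≤-trans (≤-reflexive (count-cong (λ x → sup x y))) (degR≤k y)

insertion-degree : ∀ {k} {G : Graph n} {col : Coloring n K} {u v} → Supports G col → G u v ≡ false →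
                   MaxDeg≤ k (apply G (ins u v)) → degree col (left u) < k × degree col (right v) < k
insertion-degree {G = G} {col} {u} {v} sup uncoloured (degL≤k , degR≤k) =
  <-≤-trans (count-delete v (at-cell u v refl refl) (trans (sup u v) uncoloured) row) (degL≤k u) ,
  <-≤-trans (count-delete u (at-cell u v refl refl) (trans (sup u v) uncoloured) column) (degR≤k v)
  where
  at-cell : ∀ x y → u ≡ x → v ≡ y → apply G (ins u v) x y ≡ true
  at-cell x y u≡x v≡y with apply-cell G u v x y
  ... | inj₁ (_ , _ , a , _)  = a
  ... | inj₂ (elsewhere , _) = ⊥-elim (elsewhere (u≡x , v≡y))
  off-cell : ∀ x y → ¬ (u ≡ x × v ≡ y) → is-just (col x y) ≡ apply G (ins u v) x y
  off-cell x y elsewhere with apply-cell G u v x y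
  ... | inj₁ (u≡x , v≡y , _) = ⊥-elim (elsewhere (u≡x , v≡y))
  ... | inj₂ (_ , a , _)     = trans (sup x y) (sym a)
  row : ∀ y → y ≢ v → is-just (col u y) ≡ apply G (ins u v) u y
  row y y≢v = off-cell u y λ (_ , v≡y) → y≢v (sym v≡y)
  column : ∀ x → x ≢ u → is-just (col x v) ≡ apply G (ins u v) x v
  column x x≢u = off-cell x v λ (u≡x , _) → x≢u (sym u≡x)

recolorings-sum : ∀ (G : Graph n) (c c′ : Coloring n K) →
                  recolorings G c c′ ≡ ∑[ x < n ] count (λ y → G x y ∧ differ (c x y) (c′ x y))
recolorings-sum G c c′ = sum-map-allFin (λ x → count (λ y → G x y ∧ differ (c x y) (c′ x y)))

recolorings≤changes : ∀ (G : Graph n) (c c′ : Coloring n K) → recolorings G c c′ ≤ changes c c′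
recolorings≤changes G c c′ = ≤-trans (≤-reflexive (recolorings-sum G c c′))
  (sum-mono-≤ λ x → count-mono λ y → ∧-conicalʳ (G x y) _)

recolorings≤edges : ∀ {k} (G : Graph n) (c c′ : Coloring n K) → MaxDeg≤ k G → recolorings G c c′ ≤ n * k
recolorings≤edges {n} {k = k} G c c′ (degL≤k , _) = begin
  recolorings G c c′                                  ≡⟨ recolorings-sum G c c′ ⟩
  ∑[ x < n ] count (λ y → G x y ∧ differ (c x y) (c′ x y))
    ≤⟨ sum-mono-≤ (λ x → ≤-trans (count-mono λ y → ∧-conicalˡ (G x y) _) (degL≤k x)) ⟩
  ∑[ x < n ] k                                        ≡⟨ sum-const n k ⟩
  n * k                                               ∎
  where open ≤-Reasoning

recolorings-erase : ∀ (G : Graph n) (col : Coloring n K) u v → recolorings (apply G (del u v)) col (update col u v nothing) ≡ 0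
recolorings-erase G col u v = trans (recolorings-sum _ col _) (sum-zero λ x → count-none λ y → unchanged x y)
  where
  unchanged : ∀ x y → apply G (del u v) x y ∧ differ (col x y) (update col u v nothing x y) ≡ false
  unchanged x y with apply-cell G u v x y
  ... | inj₁ (_ , _ , _ , a) rewrite a = refl
  ... | inj₂ (elsewhere , _) rewrite differ-≡ (sym (update-elsewhere col u v nothing elsewhere)) = ∧-zeroʳ _

-- Kempe chains

module Kempe {n K} (col : Coloring n K) (a b : Fin K) (w : Vertex n) where

  swap : Fin K → Fin K
  swap = transpose a b

  next : Vertex n → Maybe (Vertex n)
  next z = if sameSide w z then neighbour col a z else neighbour col b z

  -- As b is free at w, the path never revisits a vertex, so it ends
  -- within n + n steps.
  walk : ℕ → Maybe (Vertex n)
  walk zero    = just w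
  walk (suc i) = walk i >>= next

  OnPath : Vertex n → Set
  OnPath z = Σ ℕ λ i → i < n + n × walk i ≡ just z

  onPath? : ∀ z → Dec (OnPath z)
  onPath? z = anyUpTo? (λ i → Maybeₚ.≡-dec _≟ᵛ_ (walk i) (just z)) (n + n)

  -- Each path edge has exactly one left endpoint on the path, and every a- or b-edge at such a vertex
  -- lies on the path, so swapping a and b in these rows flips exactly the path.
  flipped : Coloring n K
  flipped x y = if does (onPath? (left x)) then Maybe.map swap (col x y) else col x y

  module Properties (cf : ConflictFree col) (a≢b : a ≢ b) (b-free : Free col b w) where

    swap-a : swap a ≡ b
    swap-a rewrite dec-true (a ≟ a) refl = refl

    swap-b : swap b ≡ a
    swap-b rewrite dec-false (b ≟ a) (a≢b ∘ sym) | dec-true (b ≟ b) refl = refl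

    swap-other : ∀ {c} → c ≢ a → c ≢ b → swap c ≡ c
    swap-other {c} c≢a c≢b rewrite dec-false (c ≟ a) c≢a | dec-false (c ≟ b) c≢b = refl

    InAB : Fin K → Set
    InAB c = c ≡ a ⊎ c ≡ b

    inAB? : ∀ c → InAB c ⊎ (c ≢ a × c ≢ b)
    inAB? c with c ≟ a | c ≟ b
    ... | yes c≡a | _       = inj₁ (inj₁ c≡a)
    ... | no _    | yes c≡b = inj₁ (inj₂ c≡b)
    ... | no c≢a  | no c≢b  = inj₂ (c≢a , c≢b)

    swap-involutive : ∀ c → swap (swap c) ≡ c
    swap-involutive c with inAB? c
    ... | inj₁ (inj₁ refl) = trans (cong swap swap-a) swap-b
    ... | inj₁ (inj₂ refl) = trans (cong swap swap-b) swap-a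
    ... | inj₂ (c≢a , c≢b) = trans (cong swap (swap-other c≢a c≢b)) (swap-other c≢a c≢b)

    swap-InAB : ∀ {c} → InAB c → InAB (swap c)
    swap-InAB (inj₁ refl) = inj₂ swap-a
    swap-InAB (inj₂ refl) = inj₁ swap-b

    next-Adj : ∀ z {z′} → next z ≡ just z′ →
               (sameSide w z ≡ true × Adj col a z z′) ⊎ (sameSide w z ≡ false × Adj col b z z′)
    next-Adj z e with sameSide w z
    ... | true  = inj₁ (refl , neighbour-Adj col a z e)
    ... | false = inj₂ (refl , neighbour-Adj col b z e)

    next-injective : ∀ z₁ z₂ {z′} → next z₁ ≡ just z′ → next z₂ ≡ just z′ → z₁ ≡ z₂
    next-injective z₁ z₂ {z′} e₁ e₂ with next-Adj z₁ e₁ | next-Adj z₂ e₂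
    ... | inj₁ (_ , p) | inj₁ (_ , q) = Adj-unique cf a z′ z₁ z₂ (Adj-sym col a z₁ z′ p) (Adj-sym col a z₂ z′ q)
    ... | inj₂ (_ , p) | inj₂ (_ , q) = Adj-unique cf b z′ z₁ z₂ (Adj-sym col b z₁ z′ p) (Adj-sym col b z₂ z′ q)
    ... | inj₁ (s₁ , p) | inj₂ (s₂ , q) with () ← trans (sym s₂) (trans (sameSide-trans w z₁ z₂ s₁) (Adj-common z₁ z₂ z′ p q))
    ... | inj₂ (s₁ , p) | inj₁ (s₂ , q) with () ← trans (sym s₁) (trans (sameSide-trans w z₂ z₁ s₂) (Adj-common z₂ z₁ z′ q p))

    next≢w : ∀ z → next z ≢ just w
    next≢w z e with next-Adj z e
    ... | inj₁ (s , p) with () ← trans (sym s) (trans (sameSide-sym w z) (Adj-opposite col a z w p))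
    ... | inj₂ (_ , p) = Free-¬Adj w b-free z (Adj-sym col b z w p)

    walk-pred : ∀ i {z} → walk (suc i) ≡ just z → Σ (Vertex n) λ p → walk i ≡ just p × next p ≡ just z
    walk-pred i e with walk i
    ... | just p = p , refl , e

    walk-injective : ∀ i j {z} → walk i ≡ just z → walk j ≡ just z → i ≡ j
    walk-injective zero    zero    _    _    = refl
    walk-injective zero    (suc j) refl e    with walk-pred j e
    ... | p , _ , np = ⊥-elim (next≢w p np)
    walk-injective (suc i) zero    e    refl with walk-pred i e
    ... | p , _ , np = ⊥-elim (next≢w p np)
    walk-injective (suc i) (suc j) e₁   e₂   with walk-pred i e₁ | walk-pred j e₂
    ... | p , ep , np | q , eq , nq rewrite next-injective p q np nq = cong suc (walk-injective i j ep eq)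

    walk-prefix : ∀ {i j z} → i ≤ j → walk j ≡ just z → Σ (Vertex n) λ p → walk i ≡ just p
    walk-prefix {i} {zero}  {z} z≤n e = z , e
    walk-prefix {i} {suc j} {z} i≤j e with m≤n⇒m<n∨m≡n i≤j
    ... | inj₂ refl      = z , e
    ... | inj₁ (s≤s i≤j′) with walk-pred j e
    ...   | _ , ep , _ = walk-prefix i≤j′ ep

    walk-ends : walk (n + n) ≡ nothing
    walk-ends with walk (n + n) in e
    ... | nothing = refl
    ... | just _  = ⊥-elim (no-repeat (Fin.pigeonhole (n<1+n (n + n)) (Vertex↣Fin ∘ vertexAt)))
      where
      defined : ∀ (i : Fin (suc (n + n))) → Σ (Vertex n) λ p → walk (toℕ i) ≡ just p
      defined i = walk-prefix (Fin.toℕ≤pred[n] i) e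
      vertexAt : Fin (suc (n + n)) → Vertex n
      vertexAt i = proj₁ (defined i)
      no-repeat : ¬ (Σ _ λ i → Σ _ λ j → toℕ i < toℕ j × Vertex↣Fin (vertexAt i) ≡ Vertex↣Fin (vertexAt j))
      no-repeat (i , j , i<j , same) = <⇒≢ i<j (walk-injective (toℕ i) (toℕ j) (proj₂ (defined i))
        (trans (proj₂ (defined j)) (cong just (sym (Vertex↣Fin-injective _ _ same)))))

    w-onPath : OnPath w
    w-onPath = 0 , 0<n+n , refl
      where
      0<n+n : 0 < n + n
      0<n+n with n + n | walk-ends
      ... | suc _ | _ = s≤s z≤n

    OnPath-next : ∀ {z₁ z₂} → next z₁ ≡ just z₂ → OnPath z₁ → OnPath z₂
    OnPath-next {z₁} {z₂} e (i , i<N , ei) = suc i , i+1<N , walk-suc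
      where
      walk-suc : walk (suc i) ≡ just z₂
      walk-suc rewrite ei = e
      i+1<N : suc i < n + n
      i+1<N with m≤n⇒m<n∨m≡n i<N
      ... | inj₁ lt   = lt
      ... | inj₂ i+1≡N with () ← trans (sym walk-ends) (subst (λ k → walk k ≡ just z₂) i+1≡N walk-suc)

    OnPath-prev : ∀ {z₁ z₂} → next z₁ ≡ just z₂ → OnPath z₂ → OnPath z₁
    OnPath-prev {z₁} e (zero  , _   , refl) = ⊥-elim (next≢w z₁ e)
    OnPath-prev {z₁} e (suc i , i<N , ei) with walk-pred i ei
    ... | p , ep , np = i , <-trans (n<1+n i) i<N , subst (λ r → walk i ≡ just r) (next-injective p z₁ np e) ep

    OnPath-next-⇔ : ∀ {z₁ z₂} → next z₁ ≡ just z₂ → OnPath z₁ ⇔ OnPath z₂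
    OnPath-next-⇔ e = mk⇔ (OnPath-next e) (OnPath-prev e)

    InAB-next : ∀ {c} z₁ z₂ → InAB c → Adj col c z₁ z₂ → next z₁ ≡ just z₂ ⊎ next z₂ ≡ just z₁
    InAB-next z₁ z₂ (inj₁ refl) p with sameSide w z₁ in s₁ | sameSide w z₂ in s₂
    ... | true  | _     = inj₁ (neighbour-complete cf a z₁ z₂ p)
    ... | false | true  = inj₂ (neighbour-complete cf a z₂ z₁ (Adj-sym col a z₁ z₂ p))
    ... | false | false with () ← trans (sym (opposite-opposite w z₁ z₂ s₁ s₂))
                                         (Adj-opposite col a z₁ z₂ p)
    InAB-next z₁ z₂ (inj₂ refl) p with sameSide w z₁ in s₁ | sameSide w z₂ in s₂
    ... | false | _     = inj₁ (neighbour-complete cf b z₁ z₂ p)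
    ... | true  | false = inj₂ (neighbour-complete cf b z₂ z₁ (Adj-sym col b z₁ z₂ p))
    ... | true  | true  with () ← trans (sym (Adj-opposite col b z₁ z₂ p)) (trans (sym (sameSide-trans w z₁ z₂ s₁)) s₂)

    OnPath-edge : ∀ {c x y} → InAB c → col x y ≡ just c → OnPath (left x) ⇔ OnPath (right y)
    OnPath-edge {x = x} {y} ab p with InAB-next (left x) (right y) ab p
    ... | inj₁ e = OnPath-next-⇔ e
    ... | inj₂ e = ⇔-sym (OnPath-next-⇔ e)

    flipped-on : ∀ x y → OnPath (left x) → flipped x y ≡ Maybe.map swap (col x y)
    flipped-on x y on rewrite dec-true (onPath? (left x)) on = refl

    flipped-off : ∀ x y → ¬ OnPath (left x) → flipped x y ≡ col x y
    flipped-off x y off rewrite dec-false (onPath? (left x)) off = refl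

    map-swap-≡just : ∀ {m c} → Maybe.map swap m ≡ just c ⇔ m ≡ just (swap c)
    map-swap-≡just {m} {c} = mk⇔ (to′ m) from′
      where
      to′ : ∀ m → Maybe.map swap m ≡ just c → m ≡ just (swap c)
      to′ (just d) refl = cong just (sym (swap-involutive d))
      from′ : m ≡ just (swap c) → Maybe.map swap m ≡ just c
      from′ refl = cong just (swap-involutive c)

    flipped-on-≡just : ∀ {x y c} → OnPath (left x) → flipped x y ≡ just c ⇔ col x y ≡ just (swap c)
    flipped-on-≡just {x} {y} on rewrite flipped-on x y on = map-swap-≡just

    flip-support : ∀ x y → is-just (flipped x y) ≡ is-just (col x y)
    flip-support x y = by-cases (onPath? (left x))
      where
      by-cases : Dec (OnPath (left x)) → is-just (flipped x y) ≡ is-just (col x y)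
      by-cases (yes on)  = trans (cong is-just (flipped-on x y on)) (is-just-map (col x y))
        where
        is-just-map : ∀ m → is-just (Maybe.map swap m) ≡ is-just m
        is-just-map nothing  = refl
        is-just-map (just _) = refl
      by-cases (no  off) = cong is-just (flipped-off x y off)

    flip-conflictFree : ConflictFree flipped
    flip-conflictFree = rows , cols
      where
      both-on : ∀ {x x′ y y′ c} → OnPath (left x) → OnPath (left x′) → flipped x y ≡ just c → flipped x′ y′ ≡ just c →
                col x y ≡ just (swap c) × col x′ y′ ≡ just (swap c)
      both-on on on′ e₁ e₂ = to (flipped-on-≡just on) e₁ , to (flipped-on-≡just on′) e₂
      rows : ∀ x y y′ c → flipped x y ≡ just c → flipped x y′ ≡ just c → y ≡ y′
      rows x y y′ c e₁ e₂ = by-cases (onPath? (left x))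
        where
        by-cases : Dec (OnPath (left x)) → y ≡ y′
        by-cases (yes on)  = let p , p′ = both-on on on e₁ e₂ in proj₁ cf x y y′ _ p p′
        by-cases (no  off) = proj₁ cf x y y′ c (trans (sym (flipped-off x y off)) e₁) (trans (sym (flipped-off x y′ off)) e₂)
      mixed : ∀ {x x′ y c} → OnPath (left x) → ¬ OnPath (left x′) → flipped x y ≡ just c → flipped x′ y ≡ just c → x ≡ x′
      mixed {x} {x′} {y} {c} on off e₁ e₂ with inAB? c
      ... | inj₁ ab = ⊥-elim (off (from (OnPath-edge ab p′) (to (OnPath-edge (swap-InAB ab) p) on)))
        where
        p  = to (flipped-on-≡just on) e₁
        p′ = trans (sym (flipped-off x′ y off)) e₂
      ... | inj₂ (c≢a , c≢b) = proj₂ cf x x′ y c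
                                 (subst (λ d → col x y ≡ just d) (swap-other c≢a c≢b) (to (flipped-on-≡just on) e₁))
                                 (trans (sym (flipped-off x′ y off)) e₂)
      cols : ∀ x x′ y c → flipped x y ≡ just c → flipped x′ y ≡ just c → x ≡ x′
      cols x x′ y c e₁ e₂ = by-cases (onPath? (left x)) (onPath? (left x′))
        where
        by-cases : Dec (OnPath (left x)) → Dec (OnPath (left x′)) → x ≡ x′
        by-cases (yes on)  (yes on′)  = let p , p′ = both-on on on′ e₁ e₂ in proj₂ cf x x′ y _ p p′
        by-cases (yes on)  (no  off′) = mixed on off′ e₁ e₂
        by-cases (no  off) (yes on′)  = sym (mixed on′ off e₂ e₁)
        by-cases (no  off) (no  off′) =
          proj₂ cf x x′ y c (trans (sym (flipped-off x y off)) e₁) (trans (sym (flipped-off x′ y off′)) e₂)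

    flipped-on-a : ∀ {x y} → OnPath (left x) → flipped x y ≡ just a → col x y ≡ just b
    flipped-on-a on e = subst (λ d → _ ≡ just d) swap-a (to (flipped-on-≡just on) e)

    a-free-after : Free flipped a w
    a-free-after = Free-after w w-onPath b-free
      where
      Free-after : ∀ z → OnPath z → Free col b z → Free flipped a z
      Free-after (left x)  on free y e = free y (flipped-on-a on e)
      Free-after (right y) on free x e = by-cases (onPath? (left x))
        where
        by-cases : Dec (OnPath (left x)) → ⊥
        by-cases (yes on′) = free x (flipped-on-a on′ e)
        by-cases (no  off) = off (from (OnPath-edge (inj₁ refl) (trans (sym (flipped-off x y off)) e)) on)

    OnPath-far-a-edge : ∀ z → sameSide w z ≡ false → OnPath z → Σ (Vertex n) λ p → Adj col a z p
    OnPath-far-a-edge z s (zero  , _ , refl) with () ← trans (sym (sameSide-refl w)) s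
    OnPath-far-a-edge z s (suc i , _ , e) with walk-pred i e
    ... | p , _ , np with next-Adj p np
    ...   | inj₁ (_  , q) = p , Adj-sym col a p z q
    ...   | inj₂ (sp , q) with () ← trans (sym (opposite-opposite w p z sp s)) (Adj-opposite col b p z q)

    OnPath-a-edge : ∀ z → OnPath z → (Σ (Vertex n) λ z′ → Adj col a z z′) ⊎ (next z ≡ nothing × sameSide w z ≡ true)
    OnPath-a-edge z on with sameSide w z in s
    ... | false = inj₁ (OnPath-far-a-edge z s on)
    ... | true with neighbour col a z in e
    ...   | just z′ = inj₁ (z′ , neighbour-Adj col a z e)
    ...   | nothing = inj₂ (refl , refl)

    ¬OnPath : ∀ z → sameSide w z ≡ false → Free col a z → ¬ OnPath z
    ¬OnPath z s free on = let p , q = OnPath-far-a-edge z s on in Free-¬Adj z free p q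

    Free-preserved : ∀ z → sameSide w z ≡ false → Free col a z → Free flipped a z
    Free-preserved (left x)  s free y e = free y (trans (sym (flipped-off x y (¬OnPath (left x) s free))) e)
    Free-preserved (right y) s free x e = by-cases (onPath? (left x))
      where
      by-cases : Dec (OnPath (left x)) → ⊥
      by-cases (yes on)  = ¬OnPath (right y) s free (to (OnPath-edge (inj₂ refl) (flipped-on-a on e)) on)
      by-cases (no  off) = free x (trans (sym (flipped-off x y off)) e)

    walk-stops : ∀ {i z} → walk i ≡ just z → next z ≡ nothing → walk (suc i) ≡ nothing
    walk-stops e stop rewrite e = stop

    -- Every left vertex of the path has an a-edge, except possibly its last vertex when that lies on w's side.
    Terminal : Fin n → Set
    Terminal x = OnPath (left x) × next (left x) ≡ nothing × sameSide w (left x) ≡ true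

    terminal? : ∀ x → Dec (Terminal x)
    terminal? x = onPath? (left x) ×-dec Maybeₚ.≡-dec _≟ᵛ_ (next (left x)) nothing ×-dec Bool._≟_ (sameSide w (left x)) true

    terminal : Fin n → Bool
    terminal x = does (terminal? x)

    terminal-unique : ∀ {x x′} → Terminal x → Terminal x′ → x ≡ x′
    terminal-unique ((i , _ , ei) , ni , _) ((j , _ , ej) , nj , _) with <-cmp i j
    ... | tri≈ _ refl _ = Sum.inj₁-injective (Maybeₚ.just-injective (trans (sym ei) ej))
    ... | tri< i<j _ _ with () ← trans (sym (walk-stops {i} ei ni)) (proj₂ (walk-prefix i<j ej))
    ... | tri> _ _ j<i with () ← trans (sym (walk-stops {j} ej nj)) (proj₂ (walk-prefix j<i ei))

    count-terminal≤1 : count terminal ≤ 1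
    count-terminal≤1 = count-≤1 terminal λ i j p q → terminal-unique (dec-true⁻¹ (terminal? i) p) (dec-true⁻¹ (terminal? j) q)

    atW : Fin n → Bool
    atW x = does (left x ≟ᵛ w)

    count-terminal≤atW : count terminal ≤ count atW
    count-terminal≤atW = by-side w refl
      where
      by-side : ∀ z → w ≡ z → count terminal ≤ count atW
      by-side (left x₀)  e = ≤-trans count-terminal≤1 (count-≥1 atW x₀ (dec-true (left x₀ ≟ᵛ w) (sym e)))
      by-side (right y₀) e = ≤-trans (≤-reflexive (count-none {P = terminal} none)) z≤n
        where
        none : ∀ x → terminal x ≡ false
        none x = dec-false (terminal? x) λ (_ , _ , s) → contradiction (trans (cong (λ z → sameSide z (left x)) (sym e)) s) λ ()

    OnPath-row : ∀ x → OnPath (left x) → 1 ≤ classRow col a x + [ terminal x ]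
    OnPath-row x on with OnPath-a-edge (left x) on
    ... | inj₁ (left _  , ())
    ... | inj₁ (right y , p) = ≤-trans (count-≥1 _ y (dec-true (col x y ≟ᶜ just a) p)) (m≤m+n _ _)
    ... | inj₂ (stop , s) rewrite dec-true (terminal? x) (on , stop , s) = m≤n+m 1 _

    rowChanges-flip : ∀ x → rowChanges col flipped x ≤ 2 * (classRow col a x + [ terminal x ])
    rowChanges-flip x = by-cases (onPath? (left x))
      where
      changed-colour : ∀ m → differ m (Maybe.map swap m) ≡ true → does (m ≟ᶜ just a) ∨ does (m ≟ᶜ just b) ≡ true
      changed-colour (just d) e with inAB? d
      ... | inj₁ (inj₁ refl) rewrite dec-true (just a ≟ᶜ just a) refl = refl
      ... | inj₁ (inj₂ refl) rewrite dec-true (just b ≟ᶜ just b) refl = ∨-zeroʳ _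
      ... | inj₂ (d≢a , d≢b) with () ← trans (sym e) (differ-≡ (cong just (sym (swap-other d≢a d≢b))))
      by-cases : Dec (OnPath (left x)) → rowChanges col flipped x ≤ 2 * (classRow col a x + [ terminal x ])
      by-cases (no off) = ≤-trans (≤-reflexive (count-none λ y → differ-≡ (sym (flipped-off x y off)))) z≤n
      by-cases (yes on) = begin
        count (λ y → differ (col x y) (flipped x y))
          ≤⟨ count-mono (λ y e → changed-colour (col x y) (subst (λ m → differ (col x y) m ≡ true) (flipped-on x y on) e)) ⟩
        count (λ y → does (col x y ≟ᶜ just a) ∨ does (col x y ≟ᶜ just b))
          ≤⟨ count-∨ (λ y → does (col x y ≟ᶜ just a)) (λ y → does (col x y ≟ᶜ just b)) ⟩
        classRow col a x + classRow col b x
          ≤⟨ +-mono-≤ (classRow≤1 cf a x) (classRow≤1 cf b x) ⟩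
        2 * 1
          ≤⟨ *-monoʳ-≤ 2 (OnPath-row x on) ⟩
        2 * (classRow col a x + [ terminal x ]) ∎
        where open ≤-Reasoning

    flip-cost : changes col flipped ≤ 2 * classSize col a + 2
    flip-cost = begin
      changes col flipped                                  ≤⟨ sum-mono-≤ rowChanges-flip ⟩
      ∑[ x < n ] (2 * (classRow col a x + [ terminal x ])) ≡⟨ sum-*-distribˡ 2 (λ x → classRow col a x + [ terminal x ]) ⟩
      2 * ∑[ x < n ] (classRow col a x + [ terminal x ])   ≡⟨ cong (2 *_) (∑-distrib-+ (classRow col a) (λ x → [ terminal x ])) ⟩
      2 * (classSize col a + ∑[ x < n ] [ terminal x ])    ≡⟨ cong (λ t → 2 * (classSize col a + t)) (count-sum terminal) ⟨
      2 * (classSize col a + count terminal)               ≤⟨ *-monoʳ-≤ 2 (+-monoʳ-≤ (classSize col a) count-terminal≤1) ⟩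
      2 * (classSize col a + 1)                            ≡⟨ *-distribˡ-+ 2 (classSize col a) 1 ⟩
      2 * classSize col a + 2                              ∎
      where open ≤-Reasoning

    classRow-off : ∀ {x} c → ¬ OnPath (left x) → classRow flipped c x ≡ classRow col c x
    classRow-off {x} c off = count-cong λ y → cong (λ m → does (m ≟ᶜ just c)) (flipped-off x y off)

    classRow-on : ∀ {x} c → OnPath (left x) → classRow flipped c x ≡ classRow col (swap c) x
    classRow-on {x} c on = count-cong λ y → does-⇔ (flipped-on-≡just on) (flipped x y ≟ᶜ just c) (col x y ≟ᶜ just (swap c))

    -- If w is a left vertex, its row loses its a-edge (b is free at w); this pays for the terminal row,
    -- the only row that may gain an a-edge.
    classRow-bound : ∀ x → classRow flipped a x + [ atW x ] ≤ classRow col a x + [ terminal x ]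
    classRow-bound x = by-cases (onPath? (left x)) (left x ≟ᵛ w)
      where
      open ≤-Reasoning
      by-cases : Dec (OnPath (left x)) → (d : Dec (left x ≡ w)) → classRow flipped a x + [ does d ] ≤ classRow col a x + [ terminal x ]
      by-cases (no off) (yes x≡w) = ⊥-elim (off (subst OnPath (sym x≡w) w-onPath))
      by-cases (no off) (no _) = begin
        classRow flipped a x + 0 ≡⟨ +-identityʳ _ ⟩
        classRow flipped a x     ≡⟨ classRow-off a off ⟩
        classRow col a x         ≤⟨ m≤m+n _ _ ⟩
        classRow col a x + [ terminal x ] ∎
      by-cases (yes on) (yes x≡w) = begin
        classRow flipped a x + 1 ≡⟨ cong (_+ 1) (trans (classRow-on a on) (cong (λ c → classRow col c x) swap-a)) ⟩
        classRow col b x + 1     ≡⟨ cong (_+ 1) (count-none λ y → dec-false (col x y ≟ᶜ just b) (subst (Free col b) (sym x≡w) b-free y)) ⟩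
        1                        ≤⟨ OnPath-row x on ⟩
        classRow col a x + [ terminal x ] ∎
      by-cases (yes on) (no _) = begin
        classRow flipped a x + 0 ≡⟨ +-identityʳ _ ⟩
        classRow flipped a x     ≡⟨ trans (classRow-on a on) (cong (λ c → classRow col c x) swap-a) ⟩
        classRow col b x         ≤⟨ classRow≤1 cf b x ⟩
        1                        ≤⟨ OnPath-row x on ⟩
        classRow col a x + [ terminal x ] ∎

    classSize-a : classSize flipped a ≤ classSize col a
    classSize-a = +-cancelʳ-≤ (count atW) _ _ (begin
      classSize flipped a + count atW                       ≡⟨ cong (classSize flipped a +_) (count-sum atW) ⟩
      classSize flipped a + ∑[ x < n ] [ atW x ]            ≡⟨ ∑-distrib-+ (classRow flipped a) (λ x → [ atW x ]) ⟨
      ∑[ x < n ] (classRow flipped a x + [ atW x ])         ≤⟨ sum-mono-≤ classRow-bound ⟩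
      ∑[ x < n ] (classRow col a x + [ terminal x ])        ≡⟨ ∑-distrib-+ (classRow col a) (λ x → [ terminal x ]) ⟩
      classSize col a + ∑[ x < n ] [ terminal x ]           ≡⟨ cong (classSize col a +_) (count-sum terminal) ⟨
      classSize col a + count terminal                      ≤⟨ +-monoʳ-≤ (classSize col a) count-terminal≤atW ⟩
      classSize col a + count atW                           ∎)
      where open ≤-Reasoning

    classSize-other : ∀ {c} → c ≢ a → c ≢ b → classSize flipped c ≡ classSize col c
    classSize-other {c} c≢a c≢b = sum-cong-≗ λ x → by-cases (onPath? (left x))
      where
      by-cases : ∀ {x} → Dec (OnPath (left x)) → classRow flipped c x ≡ classRow col c x
      by-cases {x} (yes on) = trans (classRow-on c on) (cong (λ d → classRow col d x) (swap-other c≢a c≢b))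
      by-cases     (no off) = classRow-off c off

    flip-preserves : ∀ {B : Set} (P : Fin K → B) → P a ≡ P b → ∀ x y → Maybe.map P (flipped x y) ≡ Maybe.map P (col x y)
    flip-preserves P Pa≡Pb x y = by-cases (onPath? (left x))
      where
      P∘swap : ∀ c → P (swap c) ≡ P c
      P∘swap c with inAB? c
      ... | inj₁ (inj₁ refl) = trans (cong P swap-a) (sym Pa≡Pb)
      ... | inj₁ (inj₂ refl) = trans (cong P swap-b) Pa≡Pb
      ... | inj₂ (c≢a , c≢b) = cong P (swap-other c≢a c≢b)
      by-cases : Dec (OnPath (left x)) → Maybe.map P (flipped x y) ≡ Maybe.map P (col x y)
      by-cases (yes on) = begin
        Maybe.map P (flipped x y)                 ≡⟨ cong (Maybe.map P) (flipped-on x y on) ⟩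
        Maybe.map P (Maybe.map swap (col x y))    ≡⟨ Maybeₚ.map-∘ (col x y) ⟨
        Maybe.map (P ∘ swap) (col x y)            ≡⟨ Maybeₚ.map-cong P∘swap (col x y) ⟩
        Maybe.map P (col x y)                     ∎
        where open ≡-Reasoning
      by-cases (no off) = cong (Maybe.map P) (flipped-off x y off)

colourWith : ∀ {n K} → Coloring n K → Fin n → Fin n → Fin K → Fin K → Coloring n K
colourWith col u v a b = update (Kempe.flipped col a b (right v)) u v (just a)

module ColourWith {n K} {col : Coloring n K} {u v : Fin n} {a b : Fin K}
                  (cf : ConflictFree col) (a≢b : a ≢ b) (a-free : Free col a (left u)) (b-free : Free col b (right v)) where

  open Kempe col a b (right v)
  open Properties cf a≢b b-free

  colourWith-conflictFree : ConflictFree (colourWith col u v a b)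
  colourWith-conflictFree = update-conflictFree flip-conflictFree (Free-preserved (left u) refl a-free) a-free-after

  colourWith-support : SameSupport (colourWith col u v a b) (update col u v (just a))
  colourWith-support = update-support u v (just a) flip-support

  colourWith-changes : changes col (colourWith col u v a b) ≤ 2 * classSize col a + 3
  colourWith-changes = begin
    changes col (colourWith col u v a b)                    ≤⟨ changes-trans col flipped _ ⟩
    changes col flipped + changes flipped (colourWith col u v a b) ≤⟨ +-mono-≤ flip-cost (changes-update flipped u v (just a)) ⟩
    (2 * classSize col a + 2) + 1                           ≡⟨ +-assoc (2 * classSize col a) 2 1 ⟩
    2 * classSize col a + 3                                 ∎
    where open ≤-Reasoning

  colourWith-preserves : ∀ {B : Set} (P : Fin K → B) → P a ≡ P b → ∀ x y → ¬ (u ≡ x × v ≡ y) →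
                         Maybe.map P (colourWith col u v a b x y) ≡ Maybe.map P (col x y)
  colourWith-preserves P Pa≡Pb x y elsewhere =
    trans (cong (Maybe.map P) (update-elsewhere flipped u v (just a) elsewhere)) (flip-preserves P Pa≡Pb x y)


-- The recolouring algorithm

module Recolouring (n k h′ : ℕ) where

  h : ℕ
  h = suc h′

  Colour : Set
  Colour = Fin (k + h)

  Colouring : Set
  Colouring = Coloring n (k + h)

  ordinary : Fin k → Colour
  ordinary i = i ↑ˡ h

  reserved : Fin h → Colour
  reserved r = k ↑ʳ r

  isReserved : Colour → Bool
  isReserved c with splitAt k c
  ... | inj₁ _ = false
  ... | inj₂ _ = true

  isReserved-ordinary : ∀ i → isReserved (ordinary i) ≡ false
  isReserved-ordinary i rewrite Fin.splitAt-↑ˡ k i h = refl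

  isReserved-reserved : ∀ r → isReserved (reserved r) ≡ true
  isReserved-reserved r rewrite Fin.splitAt-↑ʳ k h r = refl

  reserved≢ordinary : ∀ r i → reserved r ≢ ordinary i
  reserved≢ordinary r i e with () ← trans (sym (isReserved-reserved r)) (trans (cong isReserved e) (isReserved-ordinary i))

  reservedCell : Maybe Colour → Bool
  reservedCell m = fromMaybe false (Maybe.map isReserved m)

  reservedAt : Colouring → Fin n → Fin n → Bool
  reservedAt col x y = reservedCell (col x y)

  freeOrdinary : Colouring → Vertex n → Maybe Colour
  freeOrdinary col z with any? (λ i → free? col (ordinary i) z)
  ... | yes (i , _) = just (ordinary i)
  ... | no  _       = nothing

  freeOrdinary-just : ∀ col z → degree col z < k → Σ (Fin k) λ i → freeOrdinary col z ≡ just (ordinary i) × Free col (ordinary i) z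
  freeOrdinary-just col z deg<k with any? (λ i → free? col (ordinary i) z)
  ... | yes (i , free) = i , refl , free
  ... | no  none       = ⊥-elim (none (free-colour-exists ordinary (Fin.↑ˡ-injective h) z deg<k))

  reservedLoad : Colouring → ℕ
  reservedLoad col = ∑[ r < h ] classSize col (reserved r)

  leastUsed : Colouring → Colour
  leastUsed col = reserved (argmin (λ r → classSize col (reserved r)))

  leastUsed-load : ∀ col → h * classSize col (leastUsed col) ≤ reservedLoad col
  leastUsed-load col = argmin-*≤sum (λ r → classSize col (reserved r))

  reservedLoad-flip : ∀ {col : Colouring} {a b w} (cf : ConflictFree col) (a≢b : a ≢ b) (b-free : Free col b w) →
                      isReserved b ≡ false → reservedLoad (Kempe.flipped col a b w) ≤ reservedLoad col
  reservedLoad-flip {col} {a} {b} {w} cf a≢b b-free b-ordinary = sum-mono-≤ per-colour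
    where
    open Kempe.Properties col a b w cf a≢b b-free
    per-colour : ∀ r → classSize (Kempe.flipped col a b w) (reserved r) ≤ classSize col (reserved r)
    per-colour r with reserved r ≟ a
    ... | yes refl = classSize-a
    ... | no  r≢a  = ≤-reflexive (classSize-other r≢a r≢b)
      where
      r≢b : reserved r ≢ b
      r≢b e with () ← trans (sym (isReserved-reserved r)) (trans (cong isReserved e) b-ordinary)

  reservedLoad-update : ∀ (col : Colouring) u v m → reservedLoad (update col u v m) ≤ reservedLoad col + 1
  reservedLoad-update col u v m = begin
    reservedLoad (update col u v m)                              ≤⟨ sum-mono-≤ per-colour ⟩
    ∑[ r < h ] (classSize col (reserved r) + [ is r ])           ≡⟨ ∑-distrib-+ (λ r → classSize col (reserved r)) (λ r → [ is r ]) ⟩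
    reservedLoad col + ∑[ r < h ] [ is r ]                       ≡⟨ cong (reservedLoad col +_) (count-sum is) ⟨
    reservedLoad col + count is                                  ≤⟨ +-monoʳ-≤ (reservedLoad col) (count-≤1 is unique) ⟩
    reservedLoad col + 1                                         ∎
    where
    open ≤-Reasoning
    is : Fin h → Bool
    is r = does (m ≟ᶜ just (reserved r))
    unique : ∀ r s → is r ≡ true → is s ≡ true → r ≡ s
    unique r s p q = Fin.↑ʳ-injective k r s (Maybeₚ.just-injective (trans (sym (dec-true⁻¹ (m ≟ᶜ _) p)) (dec-true⁻¹ (m ≟ᶜ _) q)))
    per-colour : ∀ r → classSize (update col u v m) (reserved r) ≤ classSize col (reserved r) + [ is r ]
    per-colour r with m ≟ᶜ just (reserved r)
    ... | yes _   = classSize-update≤ col u v m (reserved r)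
    ... | no  m≢r = ≤-trans (classSize-update-other col u v (reserved r) m≢r) (m≤m+n _ 0)

  insert : Colouring → Fin n → Fin n → Colouring
  insert col u v with freeOrdinary col (left u)
  ... | nothing = col
  ... | just α with freeOrdinary (Kempe.flipped col (leastUsed col) α (left u)) (right v)
  ...   | nothing = col
  ...   | just β  = colourWith (Kempe.flipped col (leastUsed col) α (left u)) u v (leastUsed col) β

  record Inserted (col : Colouring) (u v : Fin n) (col′ : Colouring) : Set where
    field
      conflictFree : ConflictFree col′
      support      : SameSupport col′ (update col u v (just (leastUsed col)))
      changes≤     : changes col col′ ≤ 4 * classSize col (leastUsed col) + 5
      load         : reservedLoad col′ ≤ reservedLoad col + 1

  module _ {col : Colouring} {u v : Fin n} {i j : Fin k} (cf : ConflictFree col) (α-free : Free col (ordinary i) (left u)) where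

    private
      c : Colour
      c = leastUsed col
      c≢α : c ≢ ordinary i
      c≢α = reserved≢ordinary _ i
      C₁ : Colouring
      C₁ = Kempe.flipped col c (ordinary i) (left u)
      module F₁ = Kempe.Properties col c (ordinary i) (left u) cf c≢α α-free

    insert-steps : Free C₁ (ordinary j) (right v) → Inserted col u v (colourWith C₁ u v c (ordinary j))
    insert-steps β-free = record
      { conflictFree = colourWith-conflictFree
      ; support      = λ x y → trans (colourWith-support x y) (update-support u v (just c) F₁.flip-support x y)
      ; changes≤     = begin
          changes col (colourWith C₁ u v c (ordinary j))               ≤⟨ changes-trans col C₁ _ ⟩
          changes col C₁ + changes C₁ (colourWith C₁ u v c (ordinary j)) ≤⟨ +-mono-≤ F₁.flip-cost colourWith-changes ⟩
          (2 * classSize col c + 2) + (2 * classSize C₁ c + 3)          ≤⟨ +-monoʳ-≤ (2 * classSize col c + 2) (+-monoˡ-≤ 3 (*-monoʳ-≤ 2 F₁.classSize-a)) ⟩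
          (2 * classSize col c + 2) + (2 * classSize col c + 3)         ≡⟨ solve (classSize col c) ⟩
          4 * classSize col c + 5                                      ∎
      ; load         = ≤-trans (reservedLoad-update _ u v (just c))
                         (+-monoˡ-≤ 1 (≤-trans (reservedLoad-flip F₁.flip-conflictFree c≢β β-free (isReserved-ordinary j))
                                                (reservedLoad-flip cf c≢α α-free (isReserved-ordinary i))))
      }
      where
      open ≤-Reasoning
      c≢β : c ≢ ordinary j
      c≢β = reserved≢ordinary _ j
      open ColourWith F₁.flip-conflictFree c≢β F₁.a-free-after β-free
      solve : ∀ e → (2 * e + 2) + (2 * e + 3) ≡ 4 * e + 5
      solve = solve-∀
        where open import Data.Nat.Tactic.RingSolver

  insert-spec : ∀ col u v → ConflictFree col → degree col (left u) < k → degree col (right v) < k → Inserted col u v (insert col u v)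
  insert-spec col u v cf du dv with freeOrdinary-just col (left u) du
  ... | i , eα , α-free with freeOrdinary-just (Kempe.flipped col (leastUsed col) (ordinary i) (left u)) (right v) dv′
    where
    dv′ = subst (_< k) (sym (degree-cong (Kempe.Properties.flip-support col _ _ (left u) cf (reserved≢ordinary _ i) α-free) (right v))) dv
  ... | j , eβ , β-free rewrite eα | eβ = insert-steps cf α-free β-free

  reinsert : Colouring → Fin n → Fin n → Colouring
  reinsert col x y with freeOrdinary col (left x) | freeOrdinary col (right y)
  ... | just α | just β = if does (α ≟ β) then update col x y (just α) else colourWith col x y α β
  ... | _      | _      = col

  record Reinserted (col : Colouring) (x y : Fin n) (col′ : Colouring) : Set where
    field
      colour       : Colour
      unreserved   : isReserved colour ≡ false
      conflictFree : ConflictFree col′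
      at-cell      : col′ x y ≡ just colour
      off-cell     : ∀ {x′ y′} → ¬ (x ≡ x′ × y ≡ y′) →
                     is-just (col′ x′ y′) ≡ is-just (col x′ y′) × reservedAt col′ x′ y′ ≡ reservedAt col x′ y′

  reinsert-spec : ∀ col x y → ConflictFree col → degree col (left x) < k → degree col (right y) < k → Reinserted col x y (reinsert col x y)
  reinsert-spec col x y cf dx dy with freeOrdinary-just col (left x) dx | freeOrdinary-just col (right y) dy
  ... | i , eα , α-free | j , eβ , β-free rewrite eα | eβ with ordinary i ≟ ordinary j
  ... | yes α≡β = record
    { colour       = ordinary i
    ; unreserved   = isReserved-ordinary i
    ; conflictFree = update-conflictFree cf α-free (subst (λ c → Free col c (right y)) (sym α≡β) β-free)
    ; at-cell      = update-here col x y _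
    ; off-cell     = λ {x′} {y′} elsewhere →
        let s = update-elsewhere col x y _ elsewhere in cong is-just s , cong reservedCell s
    }
  ... | no α≢β = record
    { colour       = ordinary i
    ; unreserved   = isReserved-ordinary i
    ; conflictFree = colourWith-conflictFree
    ; at-cell      = update-here (Kempe.flipped col (ordinary i) (ordinary j) (right y)) x y _
    ; off-cell     = λ {x′} {y′} elsewhere →
        trans (colourWith-support x′ y′) (cong is-just (update-elsewhere col x y _ elsewhere)) ,
        cong (fromMaybe false) (colourWith-preserves isReserved (trans (isReserved-ordinary i) (sym (isReserved-ordinary j))) x′ y′ elsewhere)
    }
    where open ColourWith cf α≢β α-free β-free

  MaxDegree : Colouring → Set
  MaxDegree col = ∀ z → degree col z ≤ k

  _⊑_ : Colouring → Colouring → Set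
  col ⊑ col′ = ConflictFree col′ × SameSupport col′ col × (∀ x y → reservedAt col x y ≡ false → reservedAt col′ x y ≡ false)

  ⊑-refl : ∀ {col} → ConflictFree col → col ⊑ col
  ⊑-refl cf = cf , (λ _ _ → refl) , (λ _ _ p → p)

  ⊑-trans : ∀ {c₁ c₂ c₃} → c₁ ⊑ c₂ → c₂ ⊑ c₃ → c₁ ⊑ c₃
  ⊑-trans (_ , s₁₂ , k₁₂) (cf₃ , s₂₃ , k₂₃) = cf₃ , (λ x y → trans (s₂₃ x y) (s₁₂ x y)) , (λ x y p → k₂₃ x y (k₁₂ x y p))

  ⊑-maxDegree : ∀ {col col′} → col ⊑ col′ → MaxDegree col → MaxDegree col′
  ⊑-maxDegree (_ , same , _) md z = subst (_≤ k) (sym (degree-cong same z)) (md z)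

  reservedAt-just : ∀ col x y → reservedAt col x y ≡ true → Σ Colour λ d → col x y ≡ just d
  reservedAt-just col x y p with col x y
  reservedAt-just col x y () | nothing
  reservedAt-just col x y _  | just d = d , refl

  fixCell : Colouring → Fin n × Fin n → Colouring
  fixCell col (x , y) with reservedAt col x y
  ... | true  = reinsert (update col x y nothing) x y
  ... | false = col

  fixCell-spec : ∀ col x y → ConflictFree col → MaxDegree col → col ⊑ fixCell col (x , y) × reservedAt (fixCell col (x , y)) x y ≡ false
  fixCell-spec col x y cf md with reservedAt col x y in reserved-xy
  ... | false = ⊑-refl cf , reserved-xy
  ... | true = (conflictFree , support , keeps) , trans (cong reservedCell at-cell) unreserved
    where
    coloured : col x y ≡ just (proj₁ (reservedAt-just col x y reserved-xy))
    coloured = proj₂ (reservedAt-just col x y reserved-xy)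
    col₀ : Colouring
    col₀ = update col x y nothing
    open Reinserted (reinsert-spec col₀ x y (erase-conflictFree {u = x} {v = y} cf)
                       (<-≤-trans (erase-degree-left col x y coloured) (md (left x)))
                       (<-≤-trans (erase-degree-right col x y coloured) (md (right y))))
    support : SameSupport (reinsert col₀ x y) col
    support x′ y′ with cell? x y x′ y′
    ... | yes (refl , refl) = trans (cong is-just at-cell) (cong is-just (sym coloured))
    ... | no  elsewhere′    = trans (proj₁ (off-cell elsewhere′)) (cong is-just (update-elsewhere col x y nothing elsewhere′))
    keeps : ∀ x′ y′ → reservedAt col x′ y′ ≡ false → reservedAt (reinsert col₀ x y) x′ y′ ≡ false
    keeps x′ y′ was-unreserved with cell? x y x′ y′
    ... | yes (refl , refl) with () ← trans (sym was-unreserved) reserved-xy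
    ... | no  elsewhere′    = trans (proj₂ (off-cell elsewhere′))
                                (trans (cong reservedCell (update-elsewhere col x y nothing elsewhere′)) was-unreserved)

  fixCells-spec : ∀ ps col → ConflictFree col → MaxDegree col →
                  col ⊑ foldl fixCell col ps × (∀ {x y} → (x , y) ∈ ps → reservedAt (foldl fixCell col ps) x y ≡ false)
  fixCells-spec []             col cf md = ⊑-refl cf , λ ()
  fixCells-spec ((x , y) ∷ ps) col cf md with fixCell-spec col x y cf md
  ... | col⊑col₁ , fixed with fixCells-spec ps (fixCell col (x , y)) (proj₁ col⊑col₁) (⊑-maxDegree col⊑col₁ md)
  ...   | col₁⊑col₂ , fixed′ = ⊑-trans col⊑col₁ col₁⊑col₂ , λ { (here refl) → proj₂ (proj₂ col₁⊑col₂) x y fixed ; (there p) → fixed′ p }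

  rebuild : Colouring → Colouring
  rebuild col = foldl fixCell col (cartesianProduct (allFin n) (allFin n))

  rebuild-spec : ∀ col → ConflictFree col → MaxDegree col → col ⊑ rebuild col × (∀ x y → reservedAt (rebuild col) x y ≡ false)
  rebuild-spec col cf md with fixCells-spec (cartesianProduct (allFin n) (allFin n)) col cf md
  ... | col⊑ , fixed = col⊑ , λ x y → fixed (∈-cartesianProduct⁺ (∈-allFin x) (∈-allFin y))

  reservedLoad-unreserved : ∀ col → (∀ x y → reservedAt col x y ≡ false) → reservedLoad col ≡ 0
  reservedLoad-unreserved col unreserved = sum-zero λ r → sum-zero λ x → count-none λ y →
    dec-false (col x y ≟ᶜ just (reserved r)) λ e → contradiction (trans (sym (unreserved x y))
      (trans (cong reservedCell e) (isReserved-reserved r))) λ ()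

  module Threshold = LeastSearch (λ m → n * k ≤? m * m * h)

  m₀ : ℕ
  m₀ = Threshold.least (n * k)

  m₀-threshold : n * k ≤ m₀ * m₀ * h
  m₀-threshold = Threshold.least-satisfies {n * k} (≤-trans (x≤x*x (n * k)) (m≤m*n (n * k * (n * k)) h))
    where
    x≤x*x : ∀ x → x ≤ x * x
    x≤x*x zero    = z≤n
    x≤x*x (suc x) = m≤m*n (suc x) (suc x)

  m₀-minimal : ∀ m → n * k ≤ m * m * h → m₀ ≤ m
  m₀-minimal m = Threshold.least-minimal (n * k)

  Configuration : Set
  Configuration = Colouring × ℕ

  transition : Configuration → Update n → Configuration
  transition (col , t) (del u v) = update col u v nothing , t
  transition (col , t) (ins u v) with t <? m₀ * h
  ... | yes _ = insert col u v , suc t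
  ... | no  _ = insert (rebuild col) u v , 1

  algorithm : Algorithm n (k + h)
  algorithm = record { State = Configuration ; init = (λ _ _ → nothing) , 0 ; step = transition ; col = proj₁ }

  record Invariant (G : Graph n) (s : Configuration) : Set where
    field
      conflictFree : ConflictFree (proj₁ s)
      supports     : Supports G (proj₁ s)
      maxDeg       : MaxDeg≤ k G
      load≤        : reservedLoad (proj₁ s) ≤ proj₂ s

  step-del : ∀ {G col t} u v → Invariant G (col , t) → MaxDeg≤ k (apply G (del u v)) →
             Invariant (apply G (del u v)) (transition (col , t) (del u v))
  step-del {col = col} u v inv md′ = record
    { conflictFree = erase-conflictFree {u = u} {v = v} conflictFree
    ; supports     = supports-del u v supports
    ; maxDeg       = md′
    ; load≤        = ≤-trans (sum-mono-≤ λ r → classSize-update-other col u v {nothing} (reserved r) λ ()) load≤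
    }
    where open Invariant inv

  inserted-invariant : ∀ {G col col′ s} u v → Supports G col → MaxDeg≤ k (apply G (ins u v)) →
                       Inserted col u v col′ → reservedLoad col ≤ s → Invariant (apply G (ins u v)) (col′ , suc s)
  inserted-invariant {col = col} {s = s} u v sup md′ inserted load≤s = record
    { conflictFree = conflictFree
    ; supports     = λ x y → trans (support x y) (supports-ins u v _ sup x y)
    ; maxDeg       = md′
    ; load≤        = ≤-trans load (subst (_≤ suc s) (+-comm 1 (reservedLoad col)) (s≤s load≤s))
    }
    where open Inserted inserted

  AmortisedInsertion : Graph n → Configuration → Fin n → Fin n → Configuration → Set
  AmortisedInsertion G (col , t) u v s′ =
    Invariant (apply G (ins u v)) s′ × recolorings (apply G (ins u v)) col (proj₁ s′) + m₀ * proj₂ s′ ≤ 5 * suc m₀ + m₀ * t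

  cheap-insertion : ∀ {G col t} u v → Invariant G (col , t) → G u v ≡ false → MaxDeg≤ k (apply G (ins u v)) →
                    t < m₀ * h → AmortisedInsertion G (col , t) u v (insert col u v , suc t)
  cheap-insertion {G} {col} {t} u v inv uncoloured md′ t<threshold =
    inserted-invariant u v supports md′ inserted load≤ , (begin
      recolorings (apply G (ins u v)) col (insert col u v) + m₀ * suc t ≤⟨ +-monoˡ-≤ (m₀ * suc t) (recolorings≤changes _ col _) ⟩
      changes col (insert col u v) + m₀ * suc t                       ≤⟨ +-monoˡ-≤ (m₀ * suc t) (≤-trans changes≤ (+-monoˡ-≤ 5 (*-monoʳ-≤ 4 classSize≤m₀))) ⟩
      (4 * m₀ + 5) + m₀ * suc t                                       ≡⟨ solve m₀ t ⟩
      5 * suc m₀ + m₀ * t                                             ∎)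
    where
    open ≤-Reasoning
    open Invariant inv
    inserted = insert-spec col u v conflictFree (proj₁ (insertion-degree supports uncoloured md′)) (proj₂ (insertion-degree supports uncoloured md′))
    open Inserted inserted using (changes≤)
    classSize≤m₀ : classSize col (leastUsed col) ≤ m₀
    classSize≤m₀ = <⇒≤ (*-cancelˡ-< h _ m₀ (≤-<-trans (leastUsed-load col) (≤-<-trans load≤ (subst (t <_) (*-comm m₀ h) t<threshold))))
    solve : ∀ m t → (4 * m + 5) + m * suc t ≡ 5 * suc m + m * t
    solve = solve-∀
      where open import Data.Nat.Tactic.RingSolver

  rebuilding-insertion : ∀ {G col t} u v → Invariant G (col , t) → G u v ≡ false → MaxDeg≤ k (apply G (ins u v)) →
                         m₀ * h ≤ t → AmortisedInsertion G (col , t) u v (insert (rebuild col) u v , 1)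
  rebuilding-insertion {G} {col} {t} u v inv uncoloured md′ threshold≤t =
    inserted-invariant u v supports′ md′ inserted (≤-reflexive (reservedLoad-unreserved (rebuild col) unreserved)) , (begin
      recolorings (apply G (ins u v)) col (insert (rebuild col) u v) + m₀ * 1 ≤⟨ +-monoˡ-≤ (m₀ * 1) (recolorings≤edges _ col _ md′) ⟩
      n * k + m₀ * 1                                                         ≤⟨ +-monoˡ-≤ (m₀ * 1) (≤-trans m₀-threshold nk-paid) ⟩
      m₀ * t + m₀ * 1                                                        ≤⟨ ≤-reflexive (solve m₀ t) ⟩
      m₀ + m₀ * t                                                            ≤⟨ +-monoˡ-≤ (m₀ * t) (m≤n*m m₀ 5) ⟩
      5 * m₀ + m₀ * t                                                        ≤⟨ +-monoˡ-≤ (m₀ * t) (m≤n+m (5 * m₀) 5) ⟩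
      5 + 5 * m₀ + m₀ * t                                                    ≡⟨ cong (_+ m₀ * t) (*-suc 5 m₀) ⟨
      5 * suc m₀ + m₀ * t                                                    ∎)
    where
    open ≤-Reasoning
    open Invariant inv
    nk-paid : m₀ * m₀ * h ≤ m₀ * t
    nk-paid = ≤-trans (≤-reflexive (*-assoc m₀ m₀ h)) (*-monoʳ-≤ m₀ threshold≤t)
    col⊑ = proj₁ (rebuild-spec col conflictFree (supports-maxDegree supports maxDeg))
    unreserved = proj₂ (rebuild-spec col conflictFree (supports-maxDegree supports maxDeg))
    supports′ : Supports G (rebuild col)
    supports′ x y = trans (proj₁ (proj₂ col⊑) x y) (supports x y)
    inserted = insert-spec (rebuild col) u v (proj₁ col⊑) (proj₁ (insertion-degree supports′ uncoloured md′))
                                                          (proj₂ (insertion-degree supports′ uncoloured md′))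
    solve : ∀ m t → m * t + m * 1 ≡ m + m * t
    solve = solve-∀
      where open import Data.Nat.Tactic.RingSolver

  step-ins : ∀ {G col t} u v → Invariant G (col , t) → G u v ≡ false → MaxDeg≤ k (apply G (ins u v)) →
             AmortisedInsertion G (col , t) u v (transition (col , t) (ins u v))
  step-ins {t = t} u v inv uncoloured md′ with t <? m₀ * h
  ... | yes t<threshold = cheap-insertion u v inv uncoloured md′ t<threshold
  ... | no  t≮threshold = rebuilding-insertion u v inv uncoloured md′ (≮⇒≥ t≮threshold)

  run : ∀ xs {G col t} → Invariant G (col , t) → Valid k G xs →
        ProperAlong algorithm G (col , t) xs × cost algorithm G (col , t) xs ≤ 5 * suc m₀ * insertions xs + m₀ * t
  run []             inv _ = conflictFree-proper conflictFree supports , z≤n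
    where open Invariant inv
  run (del u v ∷ xs) {G} {col} {t} inv (_ , md′ , valid) with run xs (step-del u v inv md′) valid
  ... | proper′ , cost≤ = (conflictFree-proper conflictFree supports , proper′) ,
                          ≤-trans (≤-reflexive (cong (_+ cost algorithm (apply G (del u v)) (update col u v nothing , t) xs)
                                                     (recolorings-erase G col u v))) cost≤
    where open Invariant inv
  run (ins u v ∷ xs) {G} {col} {t} inv (uncoloured , md′ , valid) with step-ins u v inv uncoloured md′
  ... | inv′ , amortised with run xs inv′ valid
  ...   | proper′ , cost≤ = (conflictFree-proper conflictFree supports , proper′) , (begin
      r + cost algorithm G′ s′ xs                  ≤⟨ +-monoʳ-≤ r cost≤ ⟩
      r + (5 * suc m₀ * I + m₀ * proj₂ s′)         ≡⟨ solve r (5 * suc m₀ * I) (m₀ * proj₂ s′) ⟩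
      5 * suc m₀ * I + (r + m₀ * proj₂ s′)         ≤⟨ +-monoʳ-≤ (5 * suc m₀ * I) amortised ⟩
      5 * suc m₀ * I + (5 * suc m₀ + m₀ * t)       ≡⟨ solve′ (5 * suc m₀) I (m₀ * t) ⟩
      5 * suc m₀ * suc I + m₀ * t                  ∎)
    where
    open ≤-Reasoning
    open Invariant inv
    G′ = apply G (ins u v)
    s′ = transition (col , t) (ins u v)
    r  = recolorings G′ col (proj₁ s′)
    I  = insertions xs
    solve : ∀ a b c → a + (b + c) ≡ b + (a + c)
    solve = solve-∀
      where open import Data.Nat.Tactic.RingSolver
    solve′ : ∀ d i p → d * i + (d + p) ≡ d * suc i + p
    solve′ = solve-∀
      where open import Data.Nat.Tactic.RingSolver

  guarantee : (xs : List (Update n)) → Valid k empty xs →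
              ProperAlong algorithm empty (init algorithm) xs ×
              ((m : ℕ) → n * k ≤ m * m * h → cost algorithm empty (init algorithm) xs ≤ 5 * suc m * insertions xs)
  guarantee xs valid with run xs initial valid
    where
    initial : Invariant empty (init algorithm)
    initial = record
      { conflictFree = (λ _ _ _ _ ()) , (λ _ _ _ _ ())
      ; supports     = λ _ _ → refl
      ; maxDeg       = (λ _ → ≤-trans (≤-reflexive (count-none {n} {λ _ → false} λ _ → refl)) z≤n)
                     , (λ _ → ≤-trans (≤-reflexive (count-none {n} {λ _ → false} λ _ → refl)) z≤n)
      ; load≤        = ≤-reflexive (reservedLoad-unreserved (λ _ _ → nothing) λ _ _ → refl)
      }
  ... | proper , cost≤ = proper , λ m m-ok → begin
      cost algorithm empty (init algorithm) xs   ≤⟨ cost≤ ⟩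
      5 * suc m₀ * insertions xs + m₀ * 0        ≡⟨ cong (5 * suc m₀ * insertions xs +_) (*-zeroʳ m₀) ⟩
      5 * suc m₀ * insertions xs + 0             ≡⟨ +-identityʳ _ ⟩
      5 * suc m₀ * insertions xs                 ≤⟨ *-monoˡ-≤ (insertions xs) (*-monoʳ-≤ 5 (s≤s (m₀-minimal m m-ok))) ⟩
      5 * suc m * insertions xs                  ∎
    where open ≤-Reasoning

lemma21 : Σ ℕ λ C → (n k h : ℕ) → 1 ≤ h →
            Σ (Algorithm n (k + h)) λ A →
              (xs : List (Update n)) → Valid k empty xs →
                ProperAlong A empty (init A) xs ×
                ((m : ℕ) → n * k ≤ m * m * h →
                   cost A empty (init A) xs ≤ C * suc m * insertions xs)
lemma21 = 5 , λ where
  n k (suc h′) _ → Recolouring.algorithm n k h′ , Recolouring.guarantee n k h′
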